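{- Let $A=\{\xi_0,\dots,\xi_{m-1}\}$ be a set of $m$ distinct points of the torus $\mathbb T=\mathbb R/\mathbb Z$ and let $\delta\in(0,1)$ with $\delta\neq\xi_i-\xi_j \pmod 1$ for all $i,j$. Then the following are equivalent: (a) the intervals of length $\delta$ are balanced with respect to $A$; (b) $f_{\mathrm{left}}$ is a bijection of $\{0,1,\dots,m-1\}$; (c) $f_{\mathrm{right}}$ is a bijection of $\{0,1,\dots,m-1\}$.
   Context: Intervals on $\mathbb T$ are taken modulo 1. The intervals of length $\delta$ are balanced with respect to $A$ if there is an integer $c$ with $\#([\xi,\xi+\delta)\cap A)\in\{c,c+1\}$ for all $\xi\in\mathbb T$. For $\ell\in\{0,\dots,m-1\}$, $f_{\mathrm{left}}(\ell)$ is the index $j$ minimizing $(\xi_\ell+\delta-\xi_j)\bmod 1$ (viewed in $[0,1)$) over $0\le j\le m-1$, and $f_{\mathrm{right}}(\ell)$ is the index $j$ minimizing $(\xi_j-\xi_\ell-\delta)\bmod 1$ over $0\le j\le m-1$ (the closest points of $A$ to the left, resp. right, of $\xi_\ell+\delta$). -}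

module Defs where

open import Level using (0ℓ)
open import Data.Nat using (ℕ; suc)
open import Data.Fin using (Fin)
open import Data.List using (List; foldr; filter; length; allFin)
open import Data.Product using (Σ; ∃; _×_)
open import Data.Sum using (_⊎_)
open import Relation.Nullary using (¬_; does)
open import Data.Bool using (if_then_else_)
open import Relation.Binary.PropositionalEquality using (_≡_)
open import Relation.Binary.Structures using (IsStrictTotalOrder)
open import Algebra.Structures using (IsCommutativeRing)
open import Function.Definitions using (Bijective)

-- Axioms of the real numbers: a complete ordered field (unique up to
-- isomorphism), with propositional equality as the equality of reals.
record RealAxioms : Set₁ where
  infixl 6 _+_ _-_
  infixl 7 _*_
  infix 4 _<_ _≤_
  field
    ℝ : Set
    0r 1r : ℝ
    _+_ _*_ : ℝ → ℝ → ℝ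
    -_ : ℝ → ℝ
    _<_ : ℝ → ℝ → Set
    isCommutativeRing : IsCommutativeRing _≡_ _+_ _*_ -_ 0r 1r
    0≢1 : ¬ (0r ≡ 1r)
    inverse : ∀ x → ¬ (x ≡ 0r) → Σ ℝ (λ y → x * y ≡ 1r)
    isStrictTotalOrder : IsStrictTotalOrder _≡_ _<_
    +-mono-< : ∀ {x y} z → x < y → x + z < y + z
    *-pos : ∀ {x y} → 0r < x → 0r < y → 0r < x * y

  _≤_ : ℝ → ℝ → Set
  x ≤ y = x < y ⊎ x ≡ y

  _-_ : ℝ → ℝ → ℝ
  x - y = x + (- y)

  field
    lub : (S : ℝ → Set) → ∃ S → (∃ λ b → ∀ x → S x → x ≤ b) →
          ∃ λ s → (∀ x → S x → x ≤ s) × (∀ b → (∀ x → S x → x ≤ b) → s ≤ b)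

  open IsStrictTotalOrder isStrictTotalOrder public using (_<?_)

module Torus (R : RealAxioms) where
  open RealAxioms R public

  -- Points of 𝕋 = ℝ/ℤ are represented by reals in [0,1).
  InUnit : ℝ → Set
  InUnit x = 0r ≤ x × x < 1r

  -- x mod 1, valid (and only used) for x in [-2,2).
  frac : ℝ → ℝ
  frac x = if does (x <? 0r)
             then (if does (x + 1r <? 0r) then x + 1r + 1r else x + 1r)
             else (if does (x <? 1r) then x else x - 1r)

  -- #([ξ, ξ+δ) ∩ A) where A = {ξ_0,...,ξ_{m-1}}
  countIn : (m : ℕ) → (Fin m → ℝ) → ℝ → ℝ → ℕ
  countIn m pts δ ξ = length (filter (λ j → frac (pts j - ξ) <? δ) (allFin m))

  Balanced : (m : ℕ) → (Fin m → ℝ) → ℝ → Set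
  Balanced m pts δ = ∃ λ (c : ℕ) → ∀ ξ → InUnit ξ →
    countIn m pts δ ξ ≡ c ⊎ countIn m pts δ ξ ≡ suc c

  -- index minimizing g, starting from candidate j0 (first minimizer kept on ties)
  argmin : (m : ℕ) → (Fin m → ℝ) → Fin m → Fin m
  argmin m g j0 = foldr (λ j best → if does (g j <? g best) then j else best) j0 (allFin m)

  fLeft : (m : ℕ) → (Fin m → ℝ) → ℝ → Fin m → Fin m
  fLeft m pts δ ℓ = argmin m (λ j → frac (pts ℓ + δ - pts j)) ℓ

  fRight : (m : ℕ) → (Fin m → ℝ) → ℝ → Fin m → Fin m
  fRight m pts δ ℓ = argmin m (λ j → frac (pts j - pts ℓ - δ)) ℓ

-- Points of 𝕋 are reals in [0, 1) and arc u v = (v - u) mod 1.  Write ξ⁺ ℓ = ξ ℓ + δ.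
-- Sliding the window [x, x + δ) to [x′, x′ + δ) changes its count by #A(I) - #(A + δ)(I),
-- where I = [x + δ, x′ + δ), so the windows are balanced iff their counts never differ by
-- more than one.  That happens iff A and A + δ interlace, i.e. every arc [ξ⁺ ℓ, ξ⁺ ℓ′)
-- contains a point of A: then each ξ j can be paired injectively with the first point of
-- A + δ after it, giving #A(I) ≤ #(A + δ)(I) + 1; otherwise the arc from ξ⁺ ℓ to the next
-- point of A after ξ⁺ ℓ′ contains ξ⁺ ℓ and ξ⁺ ℓ′ but no point of A.  Interlacing is also
-- equivalent to injectivity (hence bijectivity) of f_left and of f_right, since ℓ ≠ ℓ′ share
-- their left or right neighbour in A exactly when no point of A separates ξ⁺ ℓ from ξ⁺ ℓ′.

module Submission where

open import Defs using (RealAxioms; module Torus)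
open import Data.Fin using (Fin)
open import Data.Nat using (ℕ)
open import Data.Product using (_×_; _,_)
open import Function.Bundles using (_⇔_)
open import Function.Construct.Composition using (_⇔-∘_)
open import Function.Definitions using (Injective; Bijective)
open import Relation.Binary.PropositionalEquality using (_≡_; _≢_)
open import Relation.Nullary using (¬_)

module Counting where

  open import Data.Fin using (zero; suc)
  open import Data.Fin.Permutation using (permutation)
  open import Data.Fin.Properties using (any?; _≟_; punchOut-injective; <⇒notInjective; 0≢1+n; suc-injective)
  open import Data.List using (length; filter; tabulate)
  open import Data.Nat using (zero; suc; _+_; _∸_; _⊔_; _≤_; z≤n; s≤s; s≤s⁻¹)
  open import Data.Nat.Properties as ℕₚ using (+-0-commutativeMonoid)
  open import Data.Product using (proj₁; proj₂)
  open import Data.Sum using (_⊎_; inj₁; inj₂)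
  open import Function using (_∘_)
  open import Function.Consequences.Propositional using (strictlySurjective⇒surjective)
  open import Function.Definitions using (StrictlySurjective)
  open import Relation.Binary.PropositionalEquality
  open import Relation.Nullary using (Dec; yes; no; contradiction)
  open import Relation.Unary using (Pred; Decidable)
  open import Algebra.Properties.CommutativeMonoid.Sum +-0-commutativeMonoid
    using (sum; sum-permute; sum-cong-≗; sum-replicate-zero)

  𝟙 : ∀ {a} {A : Set a} → Dec A → ℕ
  𝟙 (yes _) = 1
  𝟙 (no _)  = 0

  𝟙-yes : ∀ {a} {A : Set a} → A → (A? : Dec A) → 𝟙 A? ≡ 1
  𝟙-yes _ (yes _) = refl
  𝟙-yes x (no ¬x) = contradiction x ¬x

  𝟙-no : ∀ {a} {A : Set a} → ¬ A → (A? : Dec A) → 𝟙 A? ≡ 0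
  𝟙-no ¬x (yes x) = contradiction x ¬x
  𝟙-no _  (no _)  = refl

  𝟙-cong : ∀ {a b} {A : Set a} {B : Set b} → (A → B) → (B → A) → (A? : Dec A) (B? : Dec B) → 𝟙 A? ≡ 𝟙 B?
  𝟙-cong f _ (yes x) B? = sym (𝟙-yes (f x) B?)
  𝟙-cong _ g (no ¬x) B? = sym (𝟙-no (¬x ∘ g) B?)

  length-filter-tabulate : ∀ {A : Set} {n p} {P : Pred A p} (P? : Decidable P) (f : Fin n → A) →
                           length (filter P? (tabulate f)) ≡ sum (λ j → 𝟙 (P? (f j)))
  length-filter-tabulate {n = zero}  P? f = refl
  length-filter-tabulate {n = suc n} P? f with P? (f zero)
  ... | yes _ = cong suc (length-filter-tabulate P? (f ∘ suc))
  ... | no _  = length-filter-tabulate P? (f ∘ suc)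

  entry≤sum : ∀ {n} (f : Fin n → ℕ) i → f i ≤ sum f
  entry≤sum f zero    = ℕₚ.m≤m+n _ _
  entry≤sum f (suc i) = ℕₚ.≤-trans (entry≤sum (f ∘ suc) i) (ℕₚ.m≤n+m _ (f zero))

  entries≤sum : ∀ {n} (f : Fin n → ℕ) {i j} → i ≢ j → f i + f j ≤ sum f
  entries≤sum f {zero}  {zero}  i≢j = contradiction refl i≢j
  entries≤sum f {zero}  {suc j} _   = ℕₚ.+-monoʳ-≤ (f zero) (entry≤sum (f ∘ suc) j)
  entries≤sum f {suc i} {zero}  _   = ℕₚ.≤-trans (ℕₚ.≤-reflexive (ℕₚ.+-comm (f (suc i)) (f zero)))
                                        (ℕₚ.+-monoʳ-≤ (f zero) (entry≤sum (f ∘ suc) i))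
  entries≤sum f {suc i} {suc j} i≢j = ℕₚ.≤-trans (entries≤sum (f ∘ suc) (i≢j ∘ cong suc)) (ℕₚ.m≤n+m _ (f zero))

  module _ {n p} {P : Pred (Fin n) p} (P? : Decidable P) where

    count≡0 : (∀ i → ¬ P i) → sum (λ i → 𝟙 (P? i)) ≡ 0
    count≡0 none = trans (sum-cong-≗ (λ i → 𝟙-no (none i) (P? i))) (sum-replicate-zero n)

    2≤count : ∀ {i j} → i ≢ j → P i → P j → 2 ≤ sum (λ i → 𝟙 (P? i))
    2≤count {i} {j} i≢j pi pj =
      subst (_≤ sum (λ i → 𝟙 (P? i))) (cong₂ _+_ (𝟙-yes pi (P? i)) (𝟙-yes pj (P? j))) (entries≤sum _ i≢j)

  count≤1 : ∀ {n p} {P : Pred (Fin n) p} (P? : Decidable P) →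
            (∀ {i j} → P i → P j → i ≡ j) → sum (λ i → 𝟙 (P? i)) ≤ 1
  count≤1 {zero}  P? unique = z≤n
  count≤1 {suc n} P? unique with P? zero
  ... | yes p0 = s≤s (ℕₚ.≤-reflexive (count≡0 (P? ∘ suc) (λ i pi → 0≢1+n (unique p0 pi))))
  ... | no _   = count≤1 (P? ∘ suc) (λ pi pj → suc-injective (unique pi pj))

  injective⇒strictlySurjective : ∀ {n} {f : Fin n → Fin n} → Injective _≡_ _≡_ f → StrictlySurjective _≡_ f
  injective⇒strictlySurjective {zero}  _ ()
  injective⇒strictlySurjective {suc n} {f} inj y with any? (λ x → f x ≟ y)
  ... | yes hit = hit
  ... | no miss = contradiction (λ {x} {x′} eq → inj (punchOut-injective (avoid x) (avoid x′) eq))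
                                (<⇒notInjective (ℕₚ.n<1+n n))
    where
    avoid : ∀ x → y ≢ f x
    avoid x eq = miss (x , sym eq)

  injective⇒bijective : ∀ {n} {f : Fin n → Fin n} → Injective _≡_ _≡_ f → Bijective _≡_ _≡_ f
  injective⇒bijective inj = inj , strictlySurjective⇒surjective (injective⇒strictlySurjective inj)

  sum-reindex : ∀ {n} (f : Fin n → ℕ) {π : Fin n → Fin n} → Injective _≡_ _≡_ π → sum (f ∘ π) ≡ sum f
  sum-reindex f {π} inj = sym (sum-permute f (permutation π π⁻¹ (λ y → proj₂ (surj y)) (λ x → inj (proj₂ (surj (π x))))))
    where
    surj = injective⇒strictlySurjective inj
    π⁻¹ : Fin _ → Fin _
    π⁻¹ y = proj₁ (surj y)

  maxᶠ : ∀ {n} → (Fin n → ℕ) → ℕ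
  maxᶠ {zero}  f = 0
  maxᶠ {suc n} f = f zero ⊔ maxᶠ (f ∘ suc)

  entry≤maxᶠ : ∀ {n} (f : Fin n → ℕ) i → f i ≤ maxᶠ f
  entry≤maxᶠ f zero    = ℕₚ.m≤m⊔n (f zero) _
  entry≤maxᶠ f (suc i) = ℕₚ.≤-trans (entry≤maxᶠ (f ∘ suc) i) (ℕₚ.m≤n⊔m (f zero) _)

  maxᶠ-lub : ∀ {n} (f : Fin n → ℕ) {b} → (∀ i → f i ≤ b) → maxᶠ f ≤ b
  maxᶠ-lub {zero}  f _     = z≤n
  maxᶠ-lub {suc n} f f≤b = ℕₚ.⊔-lub (f≤b zero) (maxᶠ-lub (f ∘ suc) (f≤b ∘ suc))

  Fin-empty-or-inhabited : ∀ n → ¬ Fin n ⊎ Fin n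
  Fin-empty-or-inhabited zero    = inj₁ λ ()
  Fin-empty-or-inhabited (suc n) = inj₂ zero

  ≡∨≡suc⇒≤suc : ∀ {c n n′} → n ≡ c ⊎ n ≡ suc c → n′ ≡ c ⊎ n′ ≡ suc c → n′ ≤ suc n
  ≡∨≡suc⇒≤suc (inj₁ refl) (inj₁ refl) = ℕₚ.n≤1+n _
  ≡∨≡suc⇒≤suc (inj₁ refl) (inj₂ refl) = ℕₚ.≤-refl
  ≡∨≡suc⇒≤suc (inj₂ refl) (inj₁ refl) = ℕₚ.≤-trans (ℕₚ.n≤1+n _) (ℕₚ.n≤1+n _)
  ≡∨≡suc⇒≤suc (inj₂ refl) (inj₂ refl) = ℕₚ.n≤1+n _

  ≤≤suc⇒≡∨≡suc : ∀ {n b} → n ≤ b → b ≤ suc n → n ≡ b ∸ 1 ⊎ n ≡ suc (b ∸ 1)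
  ≤≤suc⇒≡∨≡suc {n} {zero}  n≤0 _ = inj₁ (ℕₚ.n≤0⇒n≡0 n≤0)
  ≤≤suc⇒≡∨≡suc {n} {suc b} n≤b b≤n+1 with ℕₚ.m≤n⇒m<n∨m≡n n≤b
  ... | inj₁ n<1+b = inj₁ (ℕₚ.≤-antisym (s≤s⁻¹ n<1+b) (s≤s⁻¹ b≤n+1))
  ... | inj₂ n≡1+b = inj₂ n≡1+b

module RealProperties (R : RealAxioms) where
  open Torus R

  open import Algebra.Bundles using (CommutativeRing)
  open import Algebra.Solver.Ring.AlmostCommutativeRing using (fromCommutativeRing; _-Raw-AlmostCommutative⟶_)
  open import Data.Bool using (if_then_else_)
  open import Data.Integer as ℤ using (ℤ; -[1+_]; sign; ∣_∣; _◃_; _⊖_)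
  import Data.Integer.Properties as ℤ
  open import Data.List using ([]; _∷_; foldr; allFin)
  open import Data.List.Membership.Propositional using (_∈_)
  open import Data.List.Membership.Propositional.Properties using (∈-allFin)
  open import Data.List.Relation.Unary.Any using (here; there)
  import Data.Maybe as Maybe
  open import Data.Nat as ℕ using (zero; suc)
  open import Data.Sign as Sign using (Sign)
  open import Data.Sum using (_⊎_; inj₁; inj₂)
  open import Relation.Binary.Definitions using (tri<; tri≈; tri>)
  open import Relation.Binary.PropositionalEquality
  open import Relation.Binary.Structures using (IsStrictTotalOrder)
  open import Relation.Nullary using (yes; no; does; contradiction)
  open import Relation.Nullary.Decidable using (dec⇒maybe)

  ring : CommutativeRing _ _
  ring = record { isCommutativeRing = isCommutativeRing }

  open CommutativeRing ring using
    (+-assoc; +-comm; +-identityˡ; +-identityʳ; *-assoc; *-comm; *-identityˡ; *-identityʳ;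
     -‿inverseʳ; distribʳ; zeroˡ; zeroʳ)
  open import Algebra.Properties.Ring (CommutativeRing.ring ring) using
    (-‿involutive; -0#≈0#; -‿distribˡ-*; -‿+-comm)
  open import Algebra.Properties.AbelianGroup (CommutativeRing.+-abelianGroup ring) using
    (identityʳ-unique)

  fromℕ : ℕ → ℝ
  fromℕ zero    = 0r
  fromℕ (suc n) = 1r + fromℕ n

  fromℕ-+ : ∀ m n → fromℕ (m ℕ.+ n) ≡ fromℕ m + fromℕ n
  fromℕ-+ zero    n = sym (+-identityˡ _)
  fromℕ-+ (suc m) n = trans (cong (1r +_) (fromℕ-+ m n)) (sym (+-assoc _ _ _))

  fromℕ-* : ∀ m n → fromℕ (m ℕ.* n) ≡ fromℕ m * fromℕ n
  fromℕ-* zero    n = sym (zeroˡ _)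
  fromℕ-* (suc m) n = begin
    fromℕ (n ℕ.+ m ℕ.* n)          ≡⟨ fromℕ-+ n (m ℕ.* n) ⟩
    fromℕ n + fromℕ (m ℕ.* n)      ≡⟨ cong₂ _+_ (sym (*-identityˡ _)) (fromℕ-* m n) ⟩
    1r * fromℕ n + fromℕ m * fromℕ n ≡⟨ distribʳ _ _ _ ⟨
    (1r + fromℕ m) * fromℕ n       ∎
    where open ≡-Reasoning

  fromℤ : ℤ → ℝ
  fromℤ (ℤ.+ n)    = fromℕ n
  fromℤ -[1+ n ]   = - fromℕ (suc n)

  fromℤ-neg : ∀ i → fromℤ (ℤ.- i) ≡ - fromℤ i
  fromℤ-neg -[1+ n ]      = sym (-‿involutive _)
  fromℤ-neg (ℤ.+ zero)    = sym -0#≈0#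
  fromℤ-neg (ℤ.+ (suc n)) = refl

  fromℤ-⊖ : ∀ m n → fromℤ (m ⊖ n) ≡ fromℕ m - fromℕ n
  fromℤ-⊖ zero    zero    = sym (-‿inverseʳ 0r)
  fromℤ-⊖ zero    (suc n) = sym (+-identityˡ _)
  fromℤ-⊖ (suc m) zero    = trans (sym (+-identityʳ _)) (cong (fromℕ (suc m) +_) (sym -0#≈0#))
  fromℤ-⊖ (suc m) (suc n) = begin
    fromℤ (suc m ⊖ suc n)                  ≡⟨ cong fromℤ (ℤ.[1+m]⊖[1+n]≡m⊖n m n) ⟩
    fromℤ (m ⊖ n)                          ≡⟨ fromℤ-⊖ m n ⟩
    M - N                                  ≡⟨ +-identityˡ _ ⟨
    0r + (M - N)                           ≡⟨ cong (_+ (M - N)) (-‿inverseʳ 1r) ⟨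
    (1r - 1r) + (M - N)                    ≡⟨ +-assoc _ _ _ ⟩
    1r + (- 1r + (M - N))                  ≡⟨ cong (1r +_) (+-assoc _ _ _) ⟨
    1r + ((- 1r + M) - N)                  ≡⟨ cong (λ t → 1r + (t - N)) (+-comm _ _) ⟩
    1r + ((M - 1r) - N)                    ≡⟨ cong (1r +_) (+-assoc _ _ _) ⟩
    1r + (M + (- 1r - N))                  ≡⟨ +-assoc _ _ _ ⟨
    (1r + M) + (- 1r - N)                  ≡⟨ cong ((1r + M) +_) (-‿+-comm 1r N) ⟩
    (1r + M) - (1r + N)                    ∎
    where
    open ≡-Reasoning
    M = fromℕ m
    N = fromℕ n

  fromℤ-+ : ∀ i j → fromℤ (i ℤ.+ j) ≡ fromℤ i + fromℤ j
  fromℤ-+ -[1+ m ] -[1+ n ] = begin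
    - (1r + (1r + fromℕ (m ℕ.+ n)))        ≡⟨ cong (λ t → - (1r + (1r + t))) (fromℕ-+ m n) ⟩
    - (1r + (1r + (M + N)))                ≡⟨ cong (λ t → - (1r + t)) (+-assoc _ _ _) ⟨
    - (1r + ((1r + M) + N))                ≡⟨ cong (λ t → - (1r + (t + N))) (+-comm 1r M) ⟩
    - (1r + ((M + 1r) + N))                ≡⟨ cong (λ t → - (1r + t)) (+-assoc _ _ _) ⟩
    - (1r + (M + (1r + N)))                ≡⟨ cong -_ (+-assoc _ _ _) ⟨
    - ((1r + M) + (1r + N))                ≡⟨ -‿+-comm _ _ ⟨
    - (1r + M) + - (1r + N)                ∎
    where
    open ≡-Reasoning
    M = fromℕ m
    N = fromℕ n
  fromℤ-+ -[1+ m ] (ℤ.+ n)  = trans (fromℤ-⊖ n (suc m)) (+-comm _ _)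
  fromℤ-+ (ℤ.+ m)  -[1+ n ] = fromℤ-⊖ m (suc n)
  fromℤ-+ (ℤ.+ m)  (ℤ.+ n)  = fromℕ-+ m n

  fromSign : Sign → ℝ
  fromSign Sign.+ = 1r
  fromSign Sign.- = - 1r

  fromSign-* : ∀ s t → fromSign (s Sign.* t) ≡ fromSign s * fromSign t
  fromSign-* Sign.- Sign.- = begin
    1r                  ≡⟨ -‿involutive 1r ⟨
    - (- 1r)            ≡⟨ cong -_ (*-identityˡ _) ⟨
    - (1r * - 1r)       ≡⟨ -‿distribˡ-* 1r (- 1r) ⟩
    - 1r * - 1r         ∎
    where open ≡-Reasoning
  fromSign-* Sign.- Sign.+ = sym (*-identityʳ _)
  fromSign-* Sign.+ t      = sym (*-identityˡ _)

  fromℤ-◃ : ∀ s n → fromℤ (s ◃ n) ≡ fromSign s * fromℕ n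
  fromℤ-◃ s      zero    = sym (zeroʳ _)
  fromℤ-◃ Sign.- (suc n) = trans (cong -_ (sym (*-identityˡ _))) (-‿distribˡ-* _ _)
  fromℤ-◃ Sign.+ (suc n) = sym (*-identityˡ _)

  fromℤ-signAbs : ∀ i → fromℤ i ≡ fromSign (sign i) * fromℕ ∣ i ∣
  fromℤ-signAbs i = trans (cong fromℤ (sym (ℤ.◃-inverse i))) (fromℤ-◃ (sign i) ∣ i ∣)

  fromℤ-* : ∀ i j → fromℤ (i ℤ.* j) ≡ fromℤ i * fromℤ j
  fromℤ-* i j = begin
    fromℤ (i ℤ.* j)                                  ≡⟨ fromℤ-◃ (sign i Sign.* sign j) (∣ i ∣ ℕ.* ∣ j ∣) ⟩
    fromSign (sign i Sign.* sign j) * fromℕ (∣ i ∣ ℕ.* ∣ j ∣)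
      ≡⟨ cong₂ _*_ (fromSign-* (sign i) (sign j)) (fromℕ-* ∣ i ∣ ∣ j ∣) ⟩
    (S * T) * (M * N)                                ≡⟨ *-assoc _ _ _ ⟩
    S * (T * (M * N))                                ≡⟨ cong (S *_) (*-assoc _ _ _) ⟨
    S * ((T * M) * N)                                ≡⟨ cong (λ t → S * (t * N)) (*-comm T M) ⟩
    S * ((M * T) * N)                                ≡⟨ cong (S *_) (*-assoc _ _ _) ⟩
    S * (M * (T * N))                                ≡⟨ *-assoc _ _ _ ⟨
    (S * M) * (T * N)                                ≡⟨ cong₂ _*_ (fromℤ-signAbs i) (fromℤ-signAbs j) ⟨
    fromℤ i * fromℤ j                                ∎
    where
    open ≡-Reasoning
    S = fromSign (sign i)
    T = fromSign (sign j)
    M = fromℕ ∣ i ∣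
    N = fromℕ ∣ j ∣

  fromℤ-homomorphism : ℤ.+-*-rawRing -Raw-AlmostCommutative⟶ fromCommutativeRing ring
  fromℤ-homomorphism = record
    { ⟦_⟧ = fromℤ ; +-homo = fromℤ-+ ; *-homo = fromℤ-* ; -‿homo = fromℤ-neg
    ; 0-homo = refl ; 1-homo = +-identityʳ _ }

  open import Algebra.Solver.Ring ℤ.+-*-rawRing (fromCommutativeRing ring) fromℤ-homomorphism
    (λ i j → Maybe.map (cong fromℤ) (dec⇒maybe (i ℤ.≟ j)))
    public using (solve; _:+_; _:-_; :-_; _:=_; con)

  open IsStrictTotalOrder isStrictTotalOrder public using (compare) renaming (trans to <-trans; asym to <-asym)

  <-irrefl : ∀ {x} → ¬ (x < x)
  <-irrefl = IsStrictTotalOrder.irrefl isStrictTotalOrder refl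

  <-resp-≡ : ∀ {x x′ y y′} → x ≡ x′ → y ≡ y′ → x < y → x′ < y′
  <-resp-≡ refl refl x<y = x<y

  <-≤-trans : ∀ {x y z} → x < y → y ≤ z → x < z
  <-≤-trans x<y (inj₁ y<z)  = <-trans x<y y<z
  <-≤-trans x<y (inj₂ refl) = x<y

  <⇒≢ : ∀ {x y} → x < y → x ≢ y
  <⇒≢ x<y refl = <-irrefl x<y

  ≮⇒≥ : ∀ {x y} → ¬ (x < y) → y ≤ x
  ≮⇒≥ {x} {y} x≮y with compare x y
  ... | tri< x<y _ _ = contradiction x<y x≮y
  ... | tri≈ _ x≡y _ = inj₂ (sym x≡y)
  ... | tri> _ _ y<x = inj₁ y<x

  ≤⇒≯ : ∀ {x y} → x ≤ y → ¬ (y < x)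
  ≤⇒≯ (inj₁ x<y)  = <-asym x<y
  ≤⇒≯ (inj₂ refl) = <-irrefl

  ≤-antisym : ∀ {x y} → x ≤ y → y ≤ x → x ≡ y
  ≤-antisym (inj₂ x≡y) _   = x≡y
  ≤-antisym (inj₁ x<y) y≤x = contradiction x<y (≤⇒≯ y≤x)

  ≤∧≢⇒< : ∀ {x y} → x ≤ y → x ≢ y → x < y
  ≤∧≢⇒< (inj₁ x<y) _   = x<y
  ≤∧≢⇒< (inj₂ x≡y) x≢y = contradiction x≡y x≢y

  +-monoʳ-< : ∀ z {x y} → x < y → z + x < z + y
  +-monoʳ-< z {x} {y} x<y = <-resp-≡ (+-comm x z) (+-comm y z) (+-mono-< z x<y)

  +-cancelˡ-< : ∀ z {x y} → z + x < z + y → x < y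
  +-cancelˡ-< z {x} {y} lt = <-resp-≡ (cancel x) (cancel y) (+-monoʳ-< (- z) lt)
    where
    cancel : ∀ t → - z + (z + t) ≡ t
    cancel = solve 2 (λ z t → :- z :+ (z :+ t) := t) refl z

  +-cancelʳ-< : ∀ z {x y} → x + z < y + z → x < y
  +-cancelʳ-< z {x} {y} lt = +-cancelˡ-< z (<-resp-≡ (+-comm x z) (+-comm y z) lt)

  x<y⇒0<y-x : ∀ {x y} → x < y → 0r < y - x
  x<y⇒0<y-x {x} x<y = <-resp-≡ (-‿inverseʳ x) refl (+-mono-< (- x) x<y)

  x≤y⇒0≤y-x : ∀ {x y} → x ≤ y → 0r ≤ y - x
  x≤y⇒0≤y-x (inj₁ x<y)       = inj₁ (x<y⇒0<y-x x<y)
  x≤y⇒0≤y-x {x} (inj₂ refl) = inj₂ (sym (-‿inverseʳ x))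

  <-by-diff : ∀ {x y} t → y - x ≡ t → 0r < t → x < y
  <-by-diff {x} {y} t y-x≡t 0<t =
    <-resp-≡ (+-identityˡ x) (solve 2 (λ x y → (y :- x) :+ x := y) refl x y) (+-mono-< x (<-resp-≡ refl (sym y-x≡t) 0<t))

  ≤-by-diff : ∀ {x y} t → y - x ≡ t → 0r ≤ t → x ≤ y
  ≤-by-diff t y-x≡t (inj₁ 0<t) = inj₁ (<-by-diff t y-x≡t 0<t)
  ≤-by-diff {x} {y} t y-x≡t (inj₂ 0≡t) = inj₂ (begin
    x             ≡⟨ +-identityˡ x ⟨
    0r + x        ≡⟨ cong (_+ x) (trans 0≡t (sym y-x≡t)) ⟩
    (y - x) + x   ≡⟨ solve 2 (λ x y → (y :- x) :+ x := y) refl x y ⟩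
    y             ∎)
    where open ≡-Reasoning

  pos+nonneg : ∀ {x y} → 0r < x → 0r ≤ y → 0r < x + y
  pos+nonneg {x} 0<x (inj₁ 0<y)  = <-trans 0<x (<-resp-≡ (+-identityʳ x) refl (+-monoʳ-< x 0<y))
  pos+nonneg {x} 0<x (inj₂ refl) = <-resp-≡ refl (sym (+-identityʳ x)) 0<x

  nonneg+pos : ∀ {x y} → 0r ≤ x → 0r < y → 0r < x + y
  nonneg+pos {x} {y} 0≤x 0<y = <-resp-≡ refl (+-comm y x) (pos+nonneg 0<y 0≤x)

  nonneg+nonneg : ∀ {x y} → 0r ≤ x → 0r ≤ y → 0r ≤ x + y
  nonneg+nonneg (inj₁ 0<x)  0≤y = inj₁ (pos+nonneg 0<x 0≤y)
  nonneg+nonneg {y = y} (inj₂ refl) 0≤y = subst (0r ≤_) (sym (+-identityˡ y)) 0≤y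

  0<1 : 0r < 1r
  0<1 with compare 0r 1r
  ... | tri< 0<1 _ _ = 0<1
  ... | tri≈ _ 0≡1 _ = contradiction 0≡1 0≢1
  ... | tri> _ _ 1<0 = contradiction (<-resp-≡ refl -1*-1≡1 (*-pos 0<-1 0<-1)) (<-asym 1<0)
    where
    0<-1 : 0r < - 1r
    0<-1 = <-resp-≡ (-‿inverseʳ 1r) (+-identityˡ _) (+-mono-< (- 1r) 1<0)
    -1*-1≡1 : - 1r * - 1r ≡ 1r
    -1*-1≡1 = sym (fromSign-* Sign.- Sign.-)

  1≤x+1 : ∀ {x} → 0r ≤ x → 1r ≤ x + 1r
  1≤x+1 {x} = ≤-by-diff x (solve 2 (λ x o → x :+ o :- o := x) refl x 1r)

  0≤fromℕ : ∀ n → 0r ≤ fromℕ n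
  0≤fromℕ zero    = inj₂ refl
  0≤fromℕ (suc n) = inj₁ (pos+nonneg 0<1 (0≤fromℕ n))

  x+1≢x : ∀ {x} → x + 1r ≢ x
  x+1≢x {x} x+1≡x = 0≢1 (sym (identityʳ-unique x 1r x+1≡x))

  module _ {n} (g : Fin n → ℝ) where

    IsMin : Fin n → Set
    IsMin k = ∀ j → ¬ (g j < g k)

    private
      keepSmaller : Fin n → Fin n → Fin n
      keepSmaller j best = if does (g j <? g best) then j else best

      foldr-isMin : ∀ j₀ L j → j ≡ j₀ ⊎ j ∈ L → ¬ (g j < g (foldr keepSmaller j₀ L))
      foldr-isMin j₀ []      j (inj₁ refl) = <-irrefl
      foldr-isMin j₀ (x ∷ L) j j∈ with g x <? g (foldr keepSmaller j₀ L) | j∈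
      ... | yes _   | inj₂ (here refl)  = <-irrefl
      ... | yes x<r | inj₂ (there j∈L) = λ j<x → foldr-isMin j₀ L j (inj₂ j∈L) (<-trans j<x x<r)
      ... | yes x<r | inj₁ refl        = λ j<x → foldr-isMin j₀ L j (inj₁ refl) (<-trans j<x x<r)
      ... | no x≮r  | inj₂ (here refl)  = x≮r
      ... | no _    | inj₂ (there j∈L) = foldr-isMin j₀ L j (inj₂ j∈L)
      ... | no _    | inj₁ refl        = foldr-isMin j₀ L j (inj₁ refl)

    argmin-isMin : ∀ j₀ → IsMin (argmin n g j₀)
    argmin-isMin j₀ j = foldr-isMin j₀ (allFin n) j (inj₂ (∈-allFin j))

    isMin-unique : Injective _≡_ _≡_ g → ∀ {k k′} → IsMin k → IsMin k′ → k ≡ k′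
    isMin-unique g-inj {k} {k′} k-min k′-min with compare (g k) (g k′)
    ... | tri< k<k′ _ _ = contradiction k<k′ (k′-min k)
    ... | tri≈ _ k≡k′ _ = g-inj k≡k′
    ... | tri> _ _ k′<k = contradiction k′<k (k-min k′)

  isMin-cong : ∀ {n} {g h : Fin n → ℝ} → (∀ j → g j ≡ h j) → ∀ {k} → IsMin g k → IsMin h k
  isMin-cong g≗h {k} k-min j hj<hk = k-min j (<-resp-≡ (sym (g≗h j)) (sym (g≗h k)) hj<hk)

  isMin-translate : ∀ {n} {g h : Fin n → ℝ} c → (∀ j → g j + c ≡ h j) → ∀ {k} → IsMin g k → IsMin h k
  isMin-translate c g+c≡h {k} k-min j hj<hk = k-min j (+-cancelʳ-< c (<-resp-≡ (sym (g+c≡h j)) (sym (g+c≡h k)) hj<hk))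

module Circle (R : RealAxioms) where
  open Torus R
  open RealProperties R
  open Counting using (𝟙; 𝟙-yes; 𝟙-no; 𝟙-cong)

  open import Algebra.Bundles using (CommutativeRing)
  open import Data.Integer as ℤ using (-[1+_])
  open import Data.Nat as ℕ using (zero; suc)
  import Data.Nat.Properties as ℕₚ
  open import Data.Product using (∃; proj₁; proj₂)
  open import Data.Sum using (inj₁; inj₂)
  open import Relation.Binary.Bundles using (Setoid)
  open import Relation.Binary.PropositionalEquality
  import Relation.Binary.Reasoning.Setoid as SetoidReasoning
  open import Relation.Nullary using (Dec; yes; no; contradiction)

  open CommutativeRing ring using (+-assoc; +-comm; +-identityˡ; +-identityʳ; -‿inverseʳ)
  open import Algebra.Properties.Ring (CommutativeRing.ring ring) using (-0#≈0#; -‿+-comm)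
  open import Algebra.Properties.AbelianGroup (CommutativeRing.+-abelianGroup ring) using
    (∙-cancelˡ; ∙-cancelʳ; identityˡ-unique; identityʳ-unique)

  infix 4 _≡mod1_
  _≡mod1_ : ℝ → ℝ → Set
  x ≡mod1 y = ∃ λ n → x ≡ y + fromℤ n

  ≡⇒≡mod1 : ∀ {x y} → x ≡ y → x ≡mod1 y
  ≡⇒≡mod1 {x} refl = ℤ.+ 0 , sym (+-identityʳ x)

  ≡mod1-refl : ∀ {x} → x ≡mod1 x
  ≡mod1-refl = ≡⇒≡mod1 refl

  ≡mod1-sym : ∀ {x y} → x ≡mod1 y → y ≡mod1 x
  ≡mod1-sym {x} {y} (n , x≡y+n) = ℤ.- n , (begin
    y                    ≡⟨ solve 2 (λ y t → y := (y :+ t) :- t) refl y (fromℤ n) ⟩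
    (y + fromℤ n) - fromℤ n ≡⟨ cong₂ _-_ x≡y+n refl ⟨
    x - fromℤ n          ≡⟨ cong (x +_) (fromℤ-neg n) ⟨
    x + fromℤ (ℤ.- n)    ∎)
    where open ≡-Reasoning

  ≡mod1-trans : ∀ {x y z} → x ≡mod1 y → y ≡mod1 z → x ≡mod1 z
  ≡mod1-trans {x} {y} {z} (n , x≡y+n) (k , y≡z+k) = k ℤ.+ n , (begin
    x                          ≡⟨ x≡y+n ⟩
    y + fromℤ n                ≡⟨ cong (_+ fromℤ n) y≡z+k ⟩
    z + fromℤ k + fromℤ n      ≡⟨ +-assoc _ _ _ ⟩
    z + (fromℤ k + fromℤ n)    ≡⟨ cong (z +_) (fromℤ-+ k n) ⟨
    z + fromℤ (k ℤ.+ n)        ∎)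
    where open ≡-Reasoning

  ≡mod1-+ : ∀ {x x′ y y′} → x ≡mod1 x′ → y ≡mod1 y′ → x + y ≡mod1 x′ + y′
  ≡mod1-+ {x} {x′} {y} {y′} (n , x≡x′+n) (k , y≡y′+k) = n ℤ.+ k , (begin
    x + y                                  ≡⟨ cong₂ _+_ x≡x′+n y≡y′+k ⟩
    (x′ + fromℤ n) + (y′ + fromℤ k)        ≡⟨ solve 4 (λ a b c d → (a :+ c) :+ (b :+ d) := (a :+ b) :+ (c :+ d))
                                                     refl x′ y′ (fromℤ n) (fromℤ k) ⟩
    (x′ + y′) + (fromℤ n + fromℤ k)        ≡⟨ cong ((x′ + y′) +_) (fromℤ-+ n k) ⟨
    (x′ + y′) + fromℤ (n ℤ.+ k)            ∎)
    where open ≡-Reasoning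

  ≡mod1-neg : ∀ {x y} → x ≡mod1 y → - x ≡mod1 - y
  ≡mod1-neg {x} {y} (n , x≡y+n) = ℤ.- n , (begin
    - x                   ≡⟨ cong -_ x≡y+n ⟩
    - (y + fromℤ n)       ≡⟨ -‿+-comm y (fromℤ n) ⟨
    - y - fromℤ n         ≡⟨ cong (- y +_) (fromℤ-neg n) ⟨
    - y + fromℤ (ℤ.- n)   ∎)
    where open ≡-Reasoning

  ≡mod1-sub : ∀ {x x′ y y′} → x ≡mod1 x′ → y ≡mod1 y′ → x - y ≡mod1 x′ - y′
  ≡mod1-sub x≡x′ y≡y′ = ≡mod1-+ x≡x′ (≡mod1-neg y≡y′)

  mod1-setoid : Setoid _ _
  mod1-setoid = record
    { _≈_ = _≡mod1_
    ; isEquivalence = record { refl = ≡mod1-refl ; sym = ≡mod1-sym ; trans = ≡mod1-trans } }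

  inUnit-≡mod1⇒≡ : ∀ {u v} → InUnit u → InUnit v → u ≡mod1 v → u ≡ v
  inUnit-≡mod1⇒≡ {u} {v} _ _ (ℤ.+ zero , u≡v+0) = trans u≡v+0 (+-identityʳ v)
  inUnit-≡mod1⇒≡ {u} {v} (_ , u<1) (0≤v , _) (ℤ.+ (suc k) , u≡v+1+k) = contradiction u<1 (≤⇒≯ 1≤u)
    where
    1≤u : 1r ≤ u
    1≤u = ≤-by-diff (v + fromℕ k)
      (trans (cong (_- 1r) u≡v+1+k) (solve 3 (λ v o k → (v :+ (o :+ k)) :- o := v :+ k) refl v 1r (fromℕ k)))
      (nonneg+nonneg 0≤v (0≤fromℕ k))
  inUnit-≡mod1⇒≡ {u} {v} (0≤u , _) (_ , v<1) (-[1+ k ] , u≡v-1-k) = contradiction v<1 (≤⇒≯ 1≤v)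
    where
    1≤v : 1r ≤ v
    1≤v = ≤-by-diff (u + fromℕ k)
      (trans (solve 3 (λ v o k → v :- o := (v :+ :- (o :+ k)) :+ k) refl v 1r (fromℕ k)) (cong (_+ fromℕ k) (sym u≡v-1-k)))
      (nonneg+nonneg 0≤u (0≤fromℕ k))

  0-inUnit : InUnit 0r
  0-inUnit = inj₂ refl , 0<1

  frac-≡mod1 : ∀ z → frac z ≡mod1 z
  frac-≡mod1 z with z <? 0r | z + 1r <? 0r | z <? 1r
  ... | yes _ | yes _ | _     = ℤ.+ 2 , solve 2 (λ z o → z :+ o :+ o := z :+ (o :+ (o :+ con (ℤ.+ 0)))) refl z 1r
  ... | yes _ | no _  | _     = ℤ.+ 1 , solve 2 (λ z o → z :+ o := z :+ (o :+ con (ℤ.+ 0))) refl z 1r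
  ... | no _  | _     | yes _ = ℤ.+ 0 , sym (+-identityʳ z)
  ... | no _  | _     | no _  = -[1+ 0 ] , solve 2 (λ z o → z :- o := z :+ :- (o :+ con (ℤ.+ 0))) refl z 1r

  -- frac z lies in [0, 1) only for z ∈ (-2, 2).
  InFracDomain : ℝ → Set
  InFracDomain z = (0r < z + 1r + 1r) × (z < 1r + 1r)

  frac-inUnit : ∀ {z} → InFracDomain z → InUnit (frac z)
  frac-inUnit {z} (-2<z , z<2) with z <? 0r | z + 1r <? 0r | z <? 1r
  ... | yes _   | yes z+1<0 | _     = inj₁ -2<z , <-resp-≡ refl (+-identityˡ 1r) (+-mono-< 1r z+1<0)
  ... | yes z<0 | no z+1≮0  | _     = ≮⇒≥ z+1≮0 , <-resp-≡ refl (+-identityˡ 1r) (+-mono-< 1r z<0)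
  ... | no z≮0  | _         | yes z<1 = ≮⇒≥ z≮0 , z<1
  ... | no _    | _         | no z≮1  =
    x≤y⇒0≤y-x (≮⇒≥ z≮1) ,
    <-resp-≡ refl (solve 1 (λ o → o :+ o :+ :- o := o) refl 1r) (+-mono-< (- 1r) z<2)

  frac-unique : ∀ {z w} → InFracDomain z → InUnit w → z ≡mod1 w → frac z ≡ w
  frac-unique {z} dom hw z≡w = inUnit-≡mod1⇒≡ (frac-inUnit dom) hw (≡mod1-trans (frac-≡mod1 z) z≡w)

  x-0≡x : ∀ x → x - 0r ≡ x
  x-0≡x x = trans (cong (x +_) -0#≈0#) (+-identityʳ x)

  inFracDomain-+- : ∀ {u v w} → InUnit u → InUnit v → InUnit w → InFracDomain (u + v - w)
  inFracDomain-+- {u} {v} {w} (0≤u , u<1) (0≤v , v<1) (0≤w , w<1) =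
    <-resp-≡ refl (solve 4 (λ u v w o → u :+ (v :+ ((o :- w) :+ o)) := u :+ v :- w :+ o :+ o) refl u v w 1r)
      (nonneg+pos 0≤u (nonneg+pos 0≤v (pos+nonneg (x<y⇒0<y-x w<1) (inj₁ 0<1)))) ,
    <-by-diff ((1r - u) + ((1r - v) + w))
      (solve 4 (λ u v w o → (o :+ o) :- (u :+ v :- w) := (o :- u) :+ ((o :- v) :+ w)) refl u v w 1r)
      (pos+nonneg (x<y⇒0<y-x u<1) (inj₁ (pos+nonneg (x<y⇒0<y-x v<1) 0≤w)))

  inFracDomain-−- : ∀ {u v w} → InUnit u → InUnit v → InUnit w → InFracDomain (u - v - w)
  inFracDomain-−- {u} {v} {w} (0≤u , u<1) (0≤v , v<1) (0≤w , w<1) =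
    <-resp-≡ refl (solve 4 (λ u v w o → u :+ ((o :- v) :+ (o :- w)) := u :- v :- w :+ o :+ o) refl u v w 1r)
      (nonneg+pos 0≤u (pos+nonneg (x<y⇒0<y-x v<1) (inj₁ (x<y⇒0<y-x w<1)))) ,
    <-by-diff ((1r - u) + (v + (w + 1r)))
      (solve 4 (λ u v w o → (o :+ o) :- (u :- v :- w) := (o :- u) :+ (v :+ (w :+ o))) refl u v w 1r)
      (pos+nonneg (x<y⇒0<y-x u<1) (nonneg+nonneg 0≤v (inj₁ (nonneg+pos 0≤w 0<1))))

  -- Opaque: unfolding frac's case split during unification makes checking much slower.
  opaque
    arc : ℝ → ℝ → ℝ
    arc u v = frac (v - u)

    frac-diff≡arc : ∀ u v → frac (v - u) ≡ arc u v
    frac-diff≡arc u v = refl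

    arc-≡mod1 : ∀ u v → arc u v ≡mod1 v - u
    arc-≡mod1 u v = frac-≡mod1 (v - u)

    arc-inUnit : ∀ {u v} → InUnit u → InUnit v → InUnit (arc u v)
    arc-inUnit {u} {v} hu hv = frac-inUnit (subst InFracDomain (x-0≡x (v - u)) (inFracDomain-−- hv hu 0-inUnit))

  arc-unique : ∀ {u v w} → InUnit u → InUnit v → InUnit w → v - u ≡mod1 w → arc u v ≡ w
  arc-unique {u} {v} hu hv hw v-u≡w = inUnit-≡mod1⇒≡ (arc-inUnit hu hv) hw (≡mod1-trans (arc-≡mod1 u v) v-u≡w)

  data Carry (x y z : ℝ) : Set where
    carry    : z < x → x + y ≡ z + 1r → Carry x y z
    no-carry : ¬ (z < x) → x + y ≡ z → Carry x y z

  carry-of-≡mod1 : ∀ {x y z} → InUnit x → InUnit y → InUnit z → x + y ≡mod1 z → Carry x y z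
  carry-of-≡mod1 {x} {y} {z} _ (0≤y , _) _ (ℤ.+ 0 , x+y≡z+0) = no-carry (≤⇒≯ x≤z) x+y≡z
    where
    x+y≡z = trans x+y≡z+0 (+-identityʳ z)
    x≤z : x ≤ z
    x≤z = ≤-by-diff y (trans (cong (_- x) (sym x+y≡z)) (solve 2 (λ x y → x :+ y :- x := y) refl x y)) 0≤y
  carry-of-≡mod1 {x} {y} {z} _ (_ , y<1) _ (ℤ.+ 1 , x+y≡z+1+0) = carry z<x x+y≡z+1
    where
    x+y≡z+1 = trans x+y≡z+1+0 (cong (z +_) (+-identityʳ 1r))
    z<x : z < x
    z<x = <-by-diff (1r - y)
      (trans (solve 3 (λ x y z → x :- z := ((x :+ y) :- y) :- z) refl x y z)
        (trans (cong (λ t → (t - y) - z) x+y≡z+1) (solve 3 (λ y z o → ((z :+ o) :- y) :- z := o :- y) refl y z 1r)))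
      (x<y⇒0<y-x y<1)
  carry-of-≡mod1 {x} {y} {z} (_ , x<1) (_ , y<1) (0≤z , _) (ℤ.+ (suc (suc k)) , x+y≡z+2+k) = contradiction x+y<2 (≤⇒≯ 2≤x+y)
    where
    2≤x+y : 1r + 1r ≤ x + y
    2≤x+y = ≤-by-diff (z + fromℕ k)
      (trans (cong (_- (1r + 1r)) x+y≡z+2+k)
        (solve 3 (λ z o k → (z :+ (o :+ (o :+ k))) :- (o :+ o) := z :+ k) refl z 1r (fromℕ k)))
      (nonneg+nonneg 0≤z (0≤fromℕ k))
    x+y<2 : x + y < 1r + 1r
    x+y<2 = <-by-diff ((1r - x) + (1r - y)) (solve 3 (λ x y o → (o :+ o) :- (x :+ y) := (o :- x) :+ (o :- y)) refl x y 1r)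
      (pos+nonneg (x<y⇒0<y-x x<1) (inj₁ (x<y⇒0<y-x y<1)))
  carry-of-≡mod1 {x} {y} {z} (0≤x , _) (0≤y , _) (_ , z<1) (-[1+ k ] , x+y≡z-1-k) =
    contradiction x+y<0 (≤⇒≯ (nonneg+nonneg 0≤x 0≤y))
    where
    x+y<0 : x + y < 0r
    x+y<0 = <-by-diff ((1r - z) + fromℕ k)
      (trans (cong (λ t → 0r - t) x+y≡z-1-k)
        (solve 3 (λ z o k → con (ℤ.+ 0) :- (z :+ :- (o :+ k)) := (o :- z) :+ k) refl z 1r (fromℕ k)))
      (pos+nonneg (x<y⇒0<y-x z<1) (0≤fromℕ k))

  -- Opaque, so that `with arc-+ …` does not normalise this solver-generated proof.
  opaque
    arc-+ : ∀ {u v w} → InUnit u → InUnit v → InUnit w → Carry (arc u v) (arc v w) (arc u w)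
    arc-+ {u} {v} {w} hu hv hw = carry-of-≡mod1 (arc-inUnit hu hv) (arc-inUnit hv hw) (arc-inUnit hu hw) (begin
      arc u v + arc v w    ≈⟨ ≡mod1-+ (arc-≡mod1 u v) (arc-≡mod1 v w) ⟩
      (v - u) + (w - v)    ≡⟨ solve 3 (λ u v w → (v :- u) :+ (w :- v) := w :- u) refl u v w ⟩
      w - u                ≈⟨ arc-≡mod1 u w ⟨
      arc u w              ∎)
      where open SetoidReasoning mod1-setoid

  arc-self : ∀ {u} → InUnit u → arc u u ≡ 0r
  arc-self {u} hu = arc-unique hu hu 0-inUnit (≡⇒≡mod1 (-‿inverseʳ u))

  arc≡0⇒≡ : ∀ {u v} → InUnit u → InUnit v → arc u v ≡ 0r → u ≡ v
  arc≡0⇒≡ {u} {v} hu hv arc≡0 = sym (inUnit-≡mod1⇒≡ hv hu (begin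
    v                    ≡⟨ solve 2 (λ u v → v := (v :- u) :+ u) refl u v ⟩
    (v - u) + u          ≈⟨ ≡mod1-+ (arc-≡mod1 u v) (≡⇒≡mod1 refl) ⟨
    arc u v + u          ≡⟨ cong (_+ u) arc≡0 ⟩
    0r + u               ≡⟨ +-identityˡ u ⟩
    u                    ∎))
    where open SetoidReasoning mod1-setoid

  arc-pos : ∀ {u v} → InUnit u → InUnit v → u ≢ v → 0r < arc u v
  arc-pos hu hv u≢v = ≤∧≢⇒< (proj₁ (arc-inUnit hu hv)) (λ 0≡arc → u≢v (arc≡0⇒≡ hu hv (sym 0≡arc)))

  arc-injˡ : ∀ {u v w} → InUnit u → InUnit v → InUnit w → arc u w ≡ arc v w → u ≡ v
  arc-injˡ {u} {v} {w} hu hv hw eq with arc-+ hu hv hw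
  ... | carry _ sum≡ = contradiction (∙-cancelʳ (arc v w) (arc u v) 1r (trans sum≡ (trans (cong (_+ 1r) eq) (+-comm _ _))))
                                     (<⇒≢ (proj₂ (arc-inUnit hu hv)))
  ... | no-carry _ sum≡ = arc≡0⇒≡ hu hv (identityˡ-unique (arc u v) (arc v w) (trans sum≡ eq))

  arc-injʳ : ∀ {u v w} → InUnit w → InUnit u → InUnit v → arc w u ≡ arc w v → u ≡ v
  arc-injʳ {u} {v} {w} hw hu hv eq with arc-+ hw hu hv
  ... | carry _ sum≡ = contradiction (∙-cancelˡ (arc w u) (arc u v) 1r (trans sum≡ (cong (_+ 1r) (sym eq))))
                                     (<⇒≢ (proj₂ (arc-inUnit hu hv)))
  ... | no-carry _ sum≡ = arc≡0⇒≡ hu hv (identityʳ-unique (arc w u) (arc u v) (trans sum≡ (sym eq)))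

  arc-flip : ∀ {u v} → InUnit u → InUnit v → u ≢ v → arc u v + arc v u ≡ 1r
  arc-flip {u} {v} hu hv u≢v with arc-+ hu hv hu
  ... | carry _ sum≡      = trans sum≡ (trans (cong (_+ 1r) (arc-self hu)) (+-identityˡ 1r))
  ... | no-carry ≮ _      = contradiction (<-resp-≡ (sym (arc-self hu)) refl (arc-pos hu hv u≢v)) ≮

  infix 4 _∈[_,_⟩ _∈[_,_⟩?

  _∈[_,_⟩ : ℝ → ℝ → ℝ → Set
  w ∈[ u , v ⟩ = arc u w < arc u v

  _∈[_,_⟩? : ∀ w u v → Dec (w ∈[ u , v ⟩)
  w ∈[ u , v ⟩? = arc u w <? arc u v

  private
    𝟙-<-translate : ∀ {x p q y y′ c} → x + p ≡ y + c → x + q ≡ y′ + c → 𝟙 (p <? q) ≡ 𝟙 (y <? y′)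
    𝟙-<-translate {x} {c = c} eq eq′ = 𝟙-cong
      (λ p<q → +-cancelʳ-< c (<-resp-≡ eq eq′ (+-monoʳ-< x p<q)))
      (λ y<y′ → +-cancelˡ-< x (<-resp-≡ (sym eq) (sym eq′) (+-mono-< c y<y′)))
      _ _

  -- [x, z) followed by [z, w) covers [x, w), plus the whole circle once more when w ∈ [x, z).
  𝟙-arc-concat : ∀ {x z w a} → InUnit x → InUnit z → InUnit w → InUnit a →
                 𝟙 (a ∈[ x , z ⟩?) ℕ.+ 𝟙 (a ∈[ z , w ⟩?) ≡ 𝟙 (a ∈[ x , w ⟩?) ℕ.+ 𝟙 (w ∈[ x , z ⟩?)
  𝟙-arc-concat {x} {z} {w} {a} hx hz hw ha with arc-+ hx hz ha | arc-+ hx hz hw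
  ... | carry a∈xz eqa | carry w∈xz eqw = begin
    𝟙 (a ∈[ x , z ⟩?) ℕ.+ 𝟙 (a ∈[ z , w ⟩?)
      ≡⟨ cong₂ ℕ._+_ (𝟙-yes a∈xz (a ∈[ x , z ⟩?)) (𝟙-<-translate eqa eqw) ⟩
    1 ℕ.+ 𝟙 (a ∈[ x , w ⟩?)
      ≡⟨ ℕₚ.+-comm 1 _ ⟩
    𝟙 (a ∈[ x , w ⟩?) ℕ.+ 1
      ≡⟨ cong (_ ℕ.+_) (𝟙-yes w∈xz (w ∈[ x , z ⟩?)) ⟨
    𝟙 (a ∈[ x , w ⟩?) ℕ.+ 𝟙 (w ∈[ x , z ⟩?) ∎
    where open ≡-Reasoning
  ... | carry a∈xz eqa | no-carry w∉xz eqw = begin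
    𝟙 (a ∈[ x , z ⟩?) ℕ.+ 𝟙 (a ∈[ z , w ⟩?)
      ≡⟨ cong₂ ℕ._+_ (𝟙-yes a∈xz (a ∈[ x , z ⟩?)) (𝟙-no a∉zw (a ∈[ z , w ⟩?)) ⟩
    1
      ≡⟨ cong₂ ℕ._+_ (𝟙-yes (<-≤-trans a∈xz (≮⇒≥ w∉xz)) (a ∈[ x , w ⟩?)) (𝟙-no w∉xz (w ∈[ x , z ⟩?)) ⟨
    𝟙 (a ∈[ x , w ⟩?) ℕ.+ 𝟙 (w ∈[ x , z ⟩?) ∎
    where
    open ≡-Reasoning
    a∉zw : ¬ (a ∈[ z , w ⟩)
    a∉zw a∈zw = ≤⇒≯ (1≤x+1 (proj₁ (arc-inUnit hx ha)))
      (<-trans (<-resp-≡ eqa (trans eqw (sym (+-identityʳ _))) (+-monoʳ-< (arc x z) a∈zw))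
               (<-resp-≡ (sym (+-identityʳ _)) refl (proj₂ (arc-inUnit hx hw))))
  ... | no-carry a∉xz eqa | carry w∈xz eqw = begin
    𝟙 (a ∈[ x , z ⟩?) ℕ.+ 𝟙 (a ∈[ z , w ⟩?)
      ≡⟨ cong₂ ℕ._+_ (𝟙-no a∉xz (a ∈[ x , z ⟩?)) (𝟙-yes a∈zw (a ∈[ z , w ⟩?)) ⟩
    1
      ≡⟨ cong₂ ℕ._+_ (𝟙-no a∉xw (a ∈[ x , w ⟩?)) (𝟙-yes w∈xz (w ∈[ x , z ⟩?)) ⟨
    𝟙 (a ∈[ x , w ⟩?) ℕ.+ 𝟙 (w ∈[ x , z ⟩?) ∎
    where
    open ≡-Reasoning
    a∈zw : a ∈[ z , w ⟩
    a∈zw = +-cancelˡ-< (arc x z) (<-resp-≡ (sym eqa) (sym eqw)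
             (<-≤-trans (proj₂ (arc-inUnit hx ha)) (1≤x+1 (proj₁ (arc-inUnit hx hw)))))
    a∉xw : ¬ (a ∈[ x , w ⟩)
    a∉xw = ≤⇒≯ (inj₁ (<-≤-trans w∈xz (≮⇒≥ a∉xz)))
  ... | no-carry a∉xz eqa | no-carry w∉xz eqw = begin
    𝟙 (a ∈[ x , z ⟩?) ℕ.+ 𝟙 (a ∈[ z , w ⟩?)
      ≡⟨ cong₂ ℕ._+_ (𝟙-no a∉xz (a ∈[ x , z ⟩?)) (𝟙-<-translate (trans eqa (sym (+-identityʳ _)))
                                                                 (trans eqw (sym (+-identityʳ _)))) ⟩
    𝟙 (a ∈[ x , w ⟩?)
      ≡⟨ ℕₚ.+-identityʳ _ ⟨
    𝟙 (a ∈[ x , w ⟩?) ℕ.+ 0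
      ≡⟨ cong (_ ℕ.+_) (𝟙-no w∉xz (w ∈[ x , z ⟩?)) ⟨
    𝟙 (a ∈[ x , w ⟩?) ℕ.+ 𝟙 (w ∈[ x , z ⟩?) ∎
    where open ≡-Reasoning

  ∈[,⟩⇒≢ : ∀ {u v w} → InUnit u → InUnit w → w ∈[ u , v ⟩ → u ≢ v
  ∈[,⟩⇒≢ hu hw w∈uv refl = ≤⇒≯ (proj₁ (arc-inUnit hu hw)) (<-resp-≡ refl (arc-self hu) w∈uv)

  ∈[,⟩⇒arc-+<1 : ∀ {u v w} → InUnit u → InUnit v → InUnit w → w ∈[ u , v ⟩ → arc v u + arc u w < 1r
  ∈[,⟩⇒arc-+<1 {u} {v} {w} hu hv hw w∈uv =
    <-resp-≡ refl (trans (+-comm _ _) (arc-flip hu hv (∈[,⟩⇒≢ hu hw w∈uv))) (+-monoʳ-< (arc v u) w∈uv)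

  ∈[u,v⟩⇒∉[v,u⟩ : ∀ {u v w} → InUnit u → InUnit v → InUnit w → w ∈[ u , v ⟩ → ¬ (w ∈[ v , u ⟩)
  ∈[u,v⟩⇒∉[v,u⟩ {u} {v} {w} hu hv hw w∈uv with arc-+ hv hu hw
  ... | no-carry w∉vu _ = w∉vu
  ... | carry _ sum≡ = λ _ → ≤⇒≯ (proj₁ (arc-inUnit hv hw))
                               (+-cancelʳ-< 1r (<-resp-≡ sum≡ (sym (+-identityˡ 1r)) (∈[,⟩⇒arc-+<1 hu hv hw w∈uv)))

  ∈[,⟩⇒arc-< : ∀ {u v w} → InUnit u → InUnit v → InUnit w → w ∈[ u , v ⟩ → u ≢ w → arc w v < arc u v
  ∈[,⟩⇒arc-< {u} {v} {w} hu hv hw w∈uv u≢w with arc-+ hu hw hv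
  ... | carry v∈uw _       = contradiction w∈uv (<-asym v∈uw)
  ... | no-carry _ sum≡    = <-resp-≡ (+-identityˡ _) sum≡ (+-mono-< (arc w v) (arc-pos hu hw u≢w))

  ∈[,⟩⇒arc-≤ : ∀ {u v w} → InUnit u → InUnit v → InUnit w → w ∈[ u , v ⟩ → arc v u ≤ arc v w
  ∈[,⟩⇒arc-≤ {u} {v} {w} hu hv hw w∈uv with arc-+ hv hu hw
  ... | no-carry _ sum≡ = ≤-by-diff (arc u w) (trans (cong (_- arc v u) (sym sum≡)) (solve 2 (λ x y → x :+ y :- x := y) refl _ _))
                            (proj₁ (arc-inUnit hu hw))
  ... | carry _ sum≡ = contradiction (∈[,⟩⇒arc-+<1 hu hv hw w∈uv)
                                     (≤⇒≯ (subst (1r ≤_) (sym sum≡) (1≤x+1 (proj₁ (arc-inUnit hv hw)))))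

  ∈∉[,⟩⇒arc-< : ∀ {u v w w′} → InUnit u → InUnit v → InUnit w → InUnit w′ →
                w ∈[ u , v ⟩ → ¬ (w′ ∈[ u , v ⟩) → w′ ≢ v → arc w v < arc w′ v
  ∈∉[,⟩⇒arc-< {u} {v} {w} {w′} hu hv hw hw′ w∈uv w′∉uv w′≢v with arc-+ hu hw hv | arc-+ hu hw′ hv
  ... | carry v∈uw _ | _ = contradiction w∈uv (<-asym v∈uw)
  ... | no-carry _ _ | no-carry v∉uw′ _ = contradiction (arc-injʳ hu hw′ hv (≤-antisym (≮⇒≥ v∉uw′) (≮⇒≥ w′∉uv))) w′≢v
  ... | no-carry _ sum≡ | carry _ sum≡′ = <-by-diff ((1r - arc u w′) + arc u w) diff≡
                                            (pos+nonneg (x<y⇒0<y-x (proj₂ (arc-inUnit hu hw′))) (proj₁ (arc-inUnit hu hw)))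
    where
    open ≡-Reasoning
    diff≡ : arc w′ v - arc w v ≡ (1r - arc u w′) + arc u w
    diff≡ = begin
      arc w′ v - arc w v
        ≡⟨ solve 4 (λ a b c d → b :- d := ((c :+ b) :- c) :- ((a :+ d) :- a)) refl (arc u w) (arc w′ v) (arc u w′) (arc w v) ⟩
      (arc u w′ + arc w′ v - arc u w′) - (arc u w + arc w v - arc u w)
        ≡⟨ cong₂ (λ s t → (s - arc u w′) - (t - arc u w)) sum≡′ sum≡ ⟩
      (arc u v + 1r - arc u w′) - (arc u v - arc u w)
        ≡⟨ solve 4 (λ a b c o → (c :+ o :- b) :- (c :- a) := (o :- b) :+ a) refl (arc u w) (arc u w′) (arc u v) 1r ⟩
      (1r - arc u w′) + arc u w
        ∎

  arc-<⇒∈[,⟩ : ∀ {u v w} → InUnit u → InUnit v → InUnit w → arc w v < arc u v → w ≢ v → w ∈[ u , v ⟩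
  arc-<⇒∈[,⟩ {u} {v} {w} hu hv hw wv<uv w≢v with arc-+ hu hw hv
  ... | no-carry _ sum≡ = <-resp-≡ (+-identityʳ _) sum≡ (+-monoʳ-< (arc u w) (arc-pos hw hv w≢v))
  ... | carry _ sum≡ = contradiction wv<uv (<-asym (<-by-diff (1r - arc u w) diff≡ (x<y⇒0<y-x (proj₂ (arc-inUnit hu hw)))))
    where
    open ≡-Reasoning
    diff≡ : arc w v - arc u v ≡ 1r - arc u w
    diff≡ = begin
      arc w v - arc u v                       ≡⟨ solve 3 (λ a b c → b :- c := (a :+ b) :- a :- c) refl (arc u w) (arc w v) (arc u v) ⟩
      (arc u w + arc w v) - arc u w - arc u v ≡⟨ cong (λ t → t - arc u w - arc u v) sum≡ ⟩
      (arc u v + 1r) - arc u w - arc u v      ≡⟨ solve 3 (λ a c o → (c :+ o) :- a :- c := o :- a) refl (arc u w) (arc u v) 1r ⟩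
      1r - arc u w                            ∎

module Configuration (R : RealAxioms) where
  open Torus R hiding (_≤_)
  open Torus R using () renaming (_≤_ to _≤ℝ_)
  open RealProperties R
  open Circle R
  open Counting

  open import Algebra.Bundles using (CommutativeRing)
  open import Data.Fin.Properties using (_≟_; any?)
  open import Data.Nat as ℕ using (suc; _≤_; _∸_)
  import Data.Nat.Properties as ℕₚ
  open import Data.Product using (∃; proj₁; proj₂)
  open import Data.Sum using (_⊎_; inj₁; inj₂)
  open import Function using (_∘_)
  open import Function.Bundles using (mk⇔)
  open import Relation.Binary.Definitions using (tri<; tri≈; tri>)
  open import Relation.Binary.PropositionalEquality
  import Relation.Binary.Reasoning.Setoid as SetoidReasoning
  open import Relation.Nullary using (Dec; yes; no; contradiction)
  open import Algebra.Properties.CommutativeMonoid.Sum ℕₚ.+-0-commutativeMonoid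
    using (sum; sum-cong-≗; ∑-distrib-+)

  open CommutativeRing ring using (+-comm)

  module Points
    (m : ℕ) (ξ : Fin m → ℝ) (δ : ℝ)
    (ξ-inUnit : ∀ i → InUnit (ξ i)) (ξ-injective : Injective _≡_ _≡_ ξ)
    (0<δ : 0r < δ) (δ<1 : δ < 1r) (δ-avoids-gaps : ∀ i j → frac (ξ i - ξ j) ≢ δ) where

    δ-inUnit : InUnit δ
    δ-inUnit = inj₁ 0<δ , δ<1

    -- Opaque for the same reason as arc.
    opaque
      shift : ℝ → ℝ
      shift u = frac (u + δ)

      unshift : ℝ → ℝ
      unshift u = frac (u - δ)

      shift-≡mod1 : ∀ u → shift u ≡mod1 u + δ
      shift-≡mod1 u = frac-≡mod1 (u + δ)

      unshift-≡mod1 : ∀ u → unshift u ≡mod1 u - δ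
      unshift-≡mod1 u = frac-≡mod1 (u - δ)

      shift-inUnit : ∀ {u} → InUnit u → InUnit (shift u)
      shift-inUnit {u} hu = frac-inUnit (subst InFracDomain (x-0≡x (u + δ)) (inFracDomain-+- hu δ-inUnit 0-inUnit))

      unshift-inUnit : ∀ {u} → InUnit u → InUnit (unshift u)
      unshift-inUnit {u} hu = frac-inUnit (subst InFracDomain (x-0≡x (u - δ)) (inFracDomain-−- hu δ-inUnit 0-inUnit))

    arc-shift : ∀ {u} → InUnit u → arc u (shift u) ≡ δ
    arc-shift {u} hu = arc-unique hu (shift-inUnit hu) δ-inUnit (begin
      shift u - u    ≈⟨ ≡mod1-sub (shift-≡mod1 u) ≡mod1-refl ⟩
      (u + δ) - u    ≡⟨ solve 2 (λ u d → (u :+ d) :- u := d) refl u δ ⟩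
      δ              ∎)
      where open SetoidReasoning mod1-setoid

    arc-shift-shift : ∀ {u v} → InUnit u → InUnit v → arc (shift u) (shift v) ≡ arc u v
    arc-shift-shift {u} {v} hu hv = arc-unique (shift-inUnit hu) (shift-inUnit hv) (arc-inUnit hu hv) (begin
      shift v - shift u    ≈⟨ ≡mod1-sub (shift-≡mod1 v) (shift-≡mod1 u) ⟩
      (v + δ) - (u + δ)    ≡⟨ solve 3 (λ u v d → (v :+ d) :- (u :+ d) := v :- u) refl u v δ ⟩
      v - u                ≈⟨ arc-≡mod1 u v ⟨
      arc u v              ∎)
      where open SetoidReasoning mod1-setoid

    shift-unshift : ∀ {u} → InUnit u → shift (unshift u) ≡ u
    shift-unshift {u} hu = inUnit-≡mod1⇒≡ (shift-inUnit (unshift-inUnit hu)) hu (begin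
      shift (unshift u)    ≈⟨ shift-≡mod1 (unshift u) ⟩
      unshift u + δ        ≈⟨ ≡mod1-+ (unshift-≡mod1 u) ≡mod1-refl ⟩
      (u - δ) + δ          ≡⟨ solve 2 (λ u d → (u :- d) :+ d := u) refl u δ ⟩
      u                    ∎)
      where open SetoidReasoning mod1-setoid

    ξ⁺ : Fin m → ℝ
    ξ⁺ j = shift (ξ j)

    ξ⁺-inUnit : ∀ j → InUnit (ξ⁺ j)
    ξ⁺-inUnit j = shift-inUnit (ξ-inUnit j)

    ξ≢ξ⁺ : ∀ i j → ξ i ≢ ξ⁺ j
    ξ≢ξ⁺ i j ξi≡ξ⁺j = δ-avoids-gaps i j (begin
      frac (ξ i - ξ j)      ≡⟨ frac-diff≡arc (ξ j) (ξ i) ⟩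
      arc (ξ j) (ξ i)       ≡⟨ cong (arc (ξ j)) ξi≡ξ⁺j ⟩
      arc (ξ j) (ξ⁺ j)      ≡⟨ arc-shift (ξ-inUnit j) ⟩
      δ                     ∎)
      where open ≡-Reasoning

    LeftNeighbour : Fin m → Fin m → Set
    LeftNeighbour ℓ = IsMin (λ j → arc (ξ j) (ξ⁺ ℓ))

    RightNeighbour : Fin m → Fin m → Set
    RightNeighbour ℓ = IsMin (λ j → arc (ξ⁺ ℓ) (ξ j))

    fL : Fin m → Fin m
    fL = fLeft m ξ δ

    fR : Fin m → Fin m
    fR = fRight m ξ δ

    fLeft-leftNeighbour : ∀ ℓ → LeftNeighbour ℓ (fL ℓ)
    fLeft-leftNeighbour ℓ = isMin-cong frac≡arc (argmin-isMin _ ℓ)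
      where
      frac≡arc : ∀ j → frac (ξ ℓ + δ - ξ j) ≡ arc (ξ j) (ξ⁺ ℓ)
      frac≡arc j = frac-unique (inFracDomain-+- (ξ-inUnit ℓ) δ-inUnit (ξ-inUnit j)) (arc-inUnit (ξ-inUnit j) (ξ⁺-inUnit ℓ)) (begin
        ξ ℓ + δ - ξ j        ≈⟨ ≡mod1-sub (shift-≡mod1 (ξ ℓ)) ≡mod1-refl ⟨
        ξ⁺ ℓ - ξ j           ≈⟨ arc-≡mod1 (ξ j) (ξ⁺ ℓ) ⟨
        arc (ξ j) (ξ⁺ ℓ)     ∎)
        where open SetoidReasoning mod1-setoid

    fRight-rightNeighbour : ∀ ℓ → RightNeighbour ℓ (fR ℓ)
    fRight-rightNeighbour ℓ = isMin-cong frac≡arc (argmin-isMin _ ℓ)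
      where
      frac≡arc : ∀ j → frac (ξ j - ξ ℓ - δ) ≡ arc (ξ⁺ ℓ) (ξ j)
      frac≡arc j = frac-unique (inFracDomain-−- (ξ-inUnit j) (ξ-inUnit ℓ) δ-inUnit) (arc-inUnit (ξ⁺-inUnit ℓ) (ξ-inUnit j)) (begin
        ξ j - ξ ℓ - δ        ≡⟨ solve 3 (λ x y d → y :- x :- d := y :- (x :+ d)) refl (ξ ℓ) (ξ j) δ ⟩
        ξ j - (ξ ℓ + δ)      ≈⟨ ≡mod1-sub ≡mod1-refl (shift-≡mod1 (ξ ℓ)) ⟨
        ξ j - ξ⁺ ℓ           ≈⟨ arc-≡mod1 (ξ⁺ ℓ) (ξ j) ⟨
        arc (ξ⁺ ℓ) (ξ j)     ∎)
        where open SetoidReasoning mod1-setoid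

    leftNeighbour-unique : ∀ {ℓ k k′} → LeftNeighbour ℓ k → LeftNeighbour ℓ k′ → k ≡ k′
    leftNeighbour-unique {ℓ} = isMin-unique _ (λ {j} {j′} eq → ξ-injective (arc-injˡ (ξ-inUnit j) (ξ-inUnit j′) (ξ⁺-inUnit ℓ) eq))

    rightNeighbour-unique : ∀ {ℓ k k′} → RightNeighbour ℓ k → RightNeighbour ℓ k′ → k ≡ k′
    rightNeighbour-unique {ℓ} = isMin-unique _ (λ {j} {j′} eq → ξ-injective (arc-injʳ (ξ⁺-inUnit ℓ) (ξ-inUnit j) (ξ-inUnit j′) eq))

    Separated : Fin m → Fin m → Set
    Separated ℓ ℓ′ = ∃ λ j → ξ j ∈[ ξ⁺ ℓ , ξ⁺ ℓ′ ⟩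

    separated? : ∀ ℓ ℓ′ → Dec (Separated ℓ ℓ′)
    separated? ℓ ℓ′ = any? (λ j → ξ j ∈[ ξ⁺ ℓ , ξ⁺ ℓ′ ⟩?)

    Interlaced : Set
    Interlaced = ∀ ℓ ℓ′ → ℓ ≢ ℓ′ → Separated ℓ ℓ′

    unseparated⇒arc-+ˡ : ∀ {ℓ ℓ′} → ¬ Separated ℓ ℓ′ → ∀ j →
                         arc (ξ j) (ξ⁺ ℓ) + arc (ξ⁺ ℓ) (ξ⁺ ℓ′) ≡ arc (ξ j) (ξ⁺ ℓ′)
    unseparated⇒arc-+ˡ {ℓ} {ℓ′} ¬sep j with arc-+ (ξ-inUnit j) (ξ⁺-inUnit ℓ) (ξ⁺-inUnit ℓ′)
    ... | no-carry _ sum≡ = sum≡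
    ... | carry _ sum≡ = contradiction (j , <-by-diff (arc (ξ j) (ξ⁺ ℓ′)) D-P≡Y Y>0) ¬sep
      where
      open ≡-Reasoning
      X = arc (ξ j) (ξ⁺ ℓ)
      D = arc (ξ⁺ ℓ) (ξ⁺ ℓ′)
      P = arc (ξ⁺ ℓ) (ξ j)
      Y = arc (ξ j) (ξ⁺ ℓ′)
      D-P≡Y : D - P ≡ Y
      D-P≡Y = begin
        D - P                 ≡⟨ solve 3 (λ x d p → d :- p := (x :+ d) :- (x :+ p)) refl X D P ⟩
        (X + D) - (X + P)     ≡⟨ cong₂ _-_ sum≡ (arc-flip (ξ-inUnit j) (ξ⁺-inUnit ℓ) (ξ≢ξ⁺ j ℓ)) ⟩
        (Y + 1r) - 1r         ≡⟨ solve 2 (λ y o → (y :+ o) :- o := y) refl Y 1r ⟩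
        Y                     ∎
      Y>0 : 0r < Y
      Y>0 = arc-pos (ξ-inUnit j) (ξ⁺-inUnit ℓ′) (ξ≢ξ⁺ j ℓ′)

    unseparated⇒arc-+ʳ : ∀ {ℓ ℓ′} → ¬ Separated ℓ ℓ′ → ∀ j →
                         arc (ξ⁺ ℓ′) (ξ j) + arc (ξ⁺ ℓ) (ξ⁺ ℓ′) ≡ arc (ξ⁺ ℓ) (ξ j)
    unseparated⇒arc-+ʳ {ℓ} {ℓ′} ¬sep j with arc-+ (ξ⁺-inUnit ℓ) (ξ⁺-inUnit ℓ′) (ξ-inUnit j)
    ... | no-carry _ sum≡ = trans (+-comm _ _) sum≡
    ... | carry ξj∈ _     = contradiction (j , ξj∈) ¬sep

    unseparated⇒leftNeighbour : ∀ {ℓ ℓ′} → ¬ Separated ℓ ℓ′ → LeftNeighbour ℓ′ (fL ℓ)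
    unseparated⇒leftNeighbour ¬sep = isMin-translate _ (unseparated⇒arc-+ˡ ¬sep) (fLeft-leftNeighbour _)

    unseparated⇒rightNeighbour : ∀ {ℓ ℓ′} → ¬ Separated ℓ ℓ′ → RightNeighbour ℓ (fR ℓ′)
    unseparated⇒rightNeighbour ¬sep = isMin-translate _ (unseparated⇒arc-+ʳ ¬sep) (fRight-rightNeighbour _)

    injective-fLeft⇒interlaced : Injective _≡_ _≡_ fL → Interlaced
    injective-fLeft⇒interlaced fL-inj ℓ ℓ′ ℓ≢ℓ′ with separated? ℓ ℓ′
    ... | yes sep  = sep
    ... | no ¬sep = contradiction (fL-inj (leftNeighbour-unique (fLeft-leftNeighbour ℓ′) (unseparated⇒leftNeighbour ¬sep)))
                                  (ℓ≢ℓ′ ∘ sym)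

    injective-fRight⇒interlaced : Injective _≡_ _≡_ fR → Interlaced
    injective-fRight⇒interlaced fR-inj ℓ ℓ′ ℓ≢ℓ′ with separated? ℓ ℓ′
    ... | yes sep  = sep
    ... | no ¬sep = contradiction (fR-inj (rightNeighbour-unique (fRight-rightNeighbour ℓ) (unseparated⇒rightNeighbour ¬sep)))
                                  ℓ≢ℓ′

    interlaced⇒injective-fLeft : Interlaced → Injective _≡_ _≡_ fL
    interlaced⇒injective-fLeft inter {ℓ} {ℓ′} fLℓ≡fLℓ′ with ℓ ≟ ℓ′
    ... | yes ℓ≡ℓ′ = ℓ≡ℓ′
    ... | no ℓ≢ℓ′ with ξ (fL ℓ) ∈[ ξ⁺ ℓ , ξ⁺ ℓ′ ⟩? | inter ℓ ℓ′ ℓ≢ℓ′ | inter ℓ′ ℓ (ℓ≢ℓ′ ∘ sym)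
    ...   | no k∉  | j , j∈ | _      = contradiction (closer j∈ k∉ (ξ≢ξ⁺ _ ℓ′)) (fLℓ-leftOfℓ′ j)
      where
      fLℓ-leftOfℓ′ : LeftNeighbour ℓ′ (fL ℓ)
      fLℓ-leftOfℓ′ = subst (LeftNeighbour ℓ′) (sym fLℓ≡fLℓ′) (fLeft-leftNeighbour ℓ′)
      closer = ∈∉[,⟩⇒arc-< (ξ⁺-inUnit ℓ) (ξ⁺-inUnit ℓ′) (ξ-inUnit _) (ξ-inUnit _)
    ...   | yes k∈ | _      | j , j∈ = contradiction (closer j∈ k∉ (ξ≢ξ⁺ _ ℓ)) (fLeft-leftNeighbour ℓ j)
      where
      k∉ = ∈[u,v⟩⇒∉[v,u⟩ (ξ⁺-inUnit ℓ) (ξ⁺-inUnit ℓ′) (ξ-inUnit _) k∈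
      closer = ∈∉[,⟩⇒arc-< (ξ⁺-inUnit ℓ′) (ξ⁺-inUnit ℓ) (ξ-inUnit _) (ξ-inUnit _)

    interlaced⇒injective-fRight : Interlaced → Injective _≡_ _≡_ fR
    interlaced⇒injective-fRight inter {ℓ} {ℓ′} fRℓ≡fRℓ′ with ℓ ≟ ℓ′
    ... | yes ℓ≡ℓ′ = ℓ≡ℓ′
    ... | no ℓ≢ℓ′ with ξ (fR ℓ) ∈[ ξ⁺ ℓ , ξ⁺ ℓ′ ⟩? | inter ℓ ℓ′ ℓ≢ℓ′ | inter ℓ′ ℓ (ℓ≢ℓ′ ∘ sym)
    ...   | no k∉  | j , j∈ | _      = contradiction (<-≤-trans j∈ (≮⇒≥ k∉)) (fRight-rightNeighbour ℓ j)
    ...   | yes k∈ | _      | j , j∈ = contradiction (<-≤-trans j∈ (≮⇒≥ k∉)) (fRℓ-rightOfℓ′ j)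
      where
      k∉ = ∈[u,v⟩⇒∉[v,u⟩ (ξ⁺-inUnit ℓ) (ξ⁺-inUnit ℓ′) (ξ-inUnit _) k∈
      fRℓ-rightOfℓ′ : RightNeighbour ℓ′ (fR ℓ)
      fRℓ-rightOfℓ′ = subst (RightNeighbour ℓ′) (sym fRℓ≡fRℓ′) (fRight-rightNeighbour ℓ′)

    interlaced⇔bijective-fLeft : Interlaced ⇔ Bijective _≡_ _≡_ fL
    interlaced⇔bijective-fLeft = mk⇔ (injective⇒bijective ∘ interlaced⇒injective-fLeft) (injective-fLeft⇒interlaced ∘ proj₁)

    interlaced⇔bijective-fRight : Interlaced ⇔ Bijective _≡_ _≡_ fR
    interlaced⇔bijective-fRight = mk⇔ (injective⇒bijective ∘ interlaced⇒injective-fRight) (injective-fRight⇒interlaced ∘ proj₁)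

    window : ℝ → ℕ
    window x = sum (λ j → 𝟙 (arc x (ξ j) <? δ))

    countIn≡window : ∀ x → countIn m ξ δ x ≡ window x
    countIn≡window x = trans (length-filter-tabulate (λ j → frac (ξ j - x) <? δ) (λ j → j))
                             (sum-cong-≗ (λ j → cong (λ t → 𝟙 (t <? δ)) (frac-diff≡arc x (ξ j))))

    #ξ : ℝ → ℝ → ℕ
    #ξ y y′ = sum (λ j → 𝟙 (ξ j ∈[ y , y′ ⟩?))

    #ξ⁺ : ℝ → ℝ → ℕ
    #ξ⁺ y y′ = sum (λ j → 𝟙 (ξ⁺ j ∈[ y , y′ ⟩?))

    #ξ≡#ξ⁺-shift : ∀ {x x′} → InUnit x → InUnit x′ → #ξ x x′ ≡ #ξ⁺ (shift x) (shift x′)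
    #ξ≡#ξ⁺-shift hx hx′ = sum-cong-≗ λ j →
      cong₂ (λ s t → 𝟙 (s <? t)) (sym (arc-shift-shift hx (ξ-inUnit j))) (sym (arc-shift-shift hx hx′))

    private
      arc-+-shift : ∀ {x x′} → InUnit x → InUnit x′ →
                    arc x x′ + arc x′ (shift x′) ≡ arc x (shift x) + arc (shift x) (shift x′)
      arc-+-shift {x} {x′} hx hx′ = begin
        arc x x′ + arc x′ (shift x′)              ≡⟨ cong (arc x x′ +_) (arc-shift hx′) ⟩
        arc x x′ + δ                              ≡⟨ +-comm _ _ ⟩
        δ + arc x x′                              ≡⟨ cong₂ _+_ (arc-shift hx) (arc-shift-shift hx hx′) ⟨
        arc x (shift x) + arc (shift x) (shift x′) ∎
        where open ≡-Reasoning

    𝟙-shift∈-window-end : ∀ {x x′} → InUnit x → InUnit x′ →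
                          𝟙 (shift x′ ∈[ x , x′ ⟩?) ≡ 𝟙 (shift x′ ∈[ x , shift x ⟩?)
    𝟙-shift∈-window-end {x} {x′} hx hx′ with arc-+ hx hx′ (shift-inUnit hx′) | arc-+ hx (shift-inUnit hx) (shift-inUnit hx′)
    ... | carry in₁ _        | carry in₂ _        = trans (𝟙-yes in₁ _) (sym (𝟙-yes in₂ _))
    ... | no-carry out₁ _    | no-carry out₂ _    = trans (𝟙-no out₁ _) (sym (𝟙-no out₂ _))
    ... | carry _ sum≡₁      | no-carry _ sum≡₂   = contradiction (trans (sym sum≡₁) (trans (arc-+-shift hx hx′) sum≡₂)) x+1≢x
    ... | no-carry _ sum≡₁   | carry _ sum≡₂      = contradiction (trans (sym sum≡₂) (trans (sym (arc-+-shift hx hx′)) sum≡₁)) x+1≢x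

    window-slide : ∀ {x x′} → InUnit x → InUnit x′ → window x′ ℕ.+ #ξ x x′ ≡ window x ℕ.+ #ξ (shift x) (shift x′)
    window-slide {x} {x′} hx hx′ =
      trans (sym (∑-distrib-+ (λ j → 𝟙 (arc x′ (ξ j) <? δ)) (λ j → 𝟙 (ξ j ∈[ x , x′ ⟩?))))
        (trans (sum-cong-≗ pointwise) (∑-distrib-+ (λ j → 𝟙 (arc x (ξ j) <? δ)) (λ j → 𝟙 (ξ j ∈[ shift x , shift x′ ⟩?))))
      where
      pointwise : ∀ j → 𝟙 (arc x′ (ξ j) <? δ) ℕ.+ 𝟙 (ξ j ∈[ x , x′ ⟩?) ≡
                        𝟙 (arc x (ξ j) <? δ) ℕ.+ 𝟙 (ξ j ∈[ shift x , shift x′ ⟩?)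
      pointwise j = begin
        𝟙 (arc x′ (ξ j) <? δ) ℕ.+ 𝟙 (ξ j ∈[ x , x′ ⟩?)
          ≡⟨ ℕₚ.+-comm (𝟙 (arc x′ (ξ j) <? δ)) _ ⟩
        𝟙 (ξ j ∈[ x , x′ ⟩?) ℕ.+ 𝟙 (arc x′ (ξ j) <? δ)
          ≡⟨ cong (λ t → 𝟙 (ξ j ∈[ x , x′ ⟩?) ℕ.+ 𝟙 (arc x′ (ξ j) <? t)) (arc-shift hx′) ⟨
        𝟙 (ξ j ∈[ x , x′ ⟩?) ℕ.+ 𝟙 (ξ j ∈[ x′ , shift x′ ⟩?)
          ≡⟨ 𝟙-arc-concat hx hx′ (shift-inUnit hx′) (ξ-inUnit j) ⟩
        𝟙 (ξ j ∈[ x , shift x′ ⟩?) ℕ.+ 𝟙 (shift x′ ∈[ x , x′ ⟩?)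
          ≡⟨ cong (𝟙 (ξ j ∈[ x , shift x′ ⟩?) ℕ.+_) (𝟙-shift∈-window-end hx hx′) ⟩
        𝟙 (ξ j ∈[ x , shift x′ ⟩?) ℕ.+ 𝟙 (shift x′ ∈[ x , shift x ⟩?)
          ≡⟨ 𝟙-arc-concat hx (shift-inUnit hx) (shift-inUnit hx′) (ξ-inUnit j) ⟨
        𝟙 (ξ j ∈[ x , shift x ⟩?) ℕ.+ 𝟙 (ξ j ∈[ shift x , shift x′ ⟩?)
          ≡⟨ cong (λ t → 𝟙 (arc x (ξ j) <? t) ℕ.+ 𝟙 (ξ j ∈[ shift x , shift x′ ⟩?)) (arc-shift hx) ⟩
        𝟙 (arc x (ξ j) <? δ) ℕ.+ 𝟙 (ξ j ∈[ shift x , shift x′ ⟩?)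
          ∎
        where open ≡-Reasoning

    window≤window-next : ∀ {x k} → InUnit x → IsMin (λ j → arc x (ξ j)) k → window x ≤ window (ξ k)
    window≤window-next {x} {k} hx k-min = begin
      window x                                        ≤⟨ ℕₚ.m≤m+n _ _ ⟩
      window x ℕ.+ #ξ (shift x) (shift (ξ k))         ≡⟨ window-slide hx (ξ-inUnit k) ⟨
      window (ξ k) ℕ.+ #ξ x (ξ k)                     ≡⟨ cong (window (ξ k) ℕ.+_) (count≡0 (λ j → ξ j ∈[ x , ξ k ⟩?) k-min) ⟩
      window (ξ k) ℕ.+ 0                              ≡⟨ ℕₚ.+-identityʳ _ ⟩
      window (ξ k)                                    ∎
      where open ℕₚ.≤-Reasoning

    Oscillation≤1 : Set
    Oscillation≤1 = ∀ {x x′} → InUnit x → InUnit x′ → window x′ ≤ suc (window x)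

    balanced⇒oscillation≤1 : Balanced m ξ δ → Oscillation≤1
    balanced⇒oscillation≤1 (c , counts) {x} {x′} hx hx′ = ≡∨≡suc⇒≤suc (windowIn x hx) (windowIn x′ hx′)
      where
      windowIn : ∀ y → InUnit y → window y ≡ c ⊎ window y ≡ suc c
      windowIn y hy = subst (λ t → t ≡ c ⊎ t ≡ suc c) (countIn≡window y) (counts y hy)

    oscillation≤1⇒balanced : Oscillation≤1 → Balanced m ξ δ
    oscillation≤1⇒balanced osc = M ∸ 1 , λ x hx →
      subst (λ t → t ≡ M ∸ 1 ⊎ t ≡ suc (M ∸ 1)) (sym (countIn≡window x)) (≤≤suc⇒≡∨≡suc (window≤M hx) (M≤ hx))
      where
      M : ℕ
      M = maxᶠ (window ∘ ξ)
      window≤M : ∀ {x} → InUnit x → window x ≤ M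
      window≤M {x} hx with Fin-empty-or-inhabited m
      ... | inj₁ empty = subst (_≤ M) (sym (count≡0 (λ j → arc x (ξ j) <? δ) (λ j → contradiction j empty))) ℕ.z≤n
      ... | inj₂ j₀    = ℕₚ.≤-trans (window≤window-next hx (argmin-isMin _ j₀)) (entry≤maxᶠ (window ∘ ξ) _)
      M≤ : ∀ {x} → InUnit x → M ≤ suc (window x)
      M≤ hx = maxᶠ-lub (window ∘ ξ) (λ k → osc hx (ξ-inUnit k))

    -- Without a point of A in [ξ⁺ ℓ, ξ⁺ ℓ′), the window at x′ = ξ (fR ℓ′) - δ has lost ξ ℓ and ξ ℓ′,
    -- and gained nothing, compared with the window at ξ ℓ.
    oscillation≤1⇒interlaced : Oscillation≤1 → Interlaced
    oscillation≤1⇒interlaced osc ℓ ℓ′ ℓ≢ℓ′ with separated? ℓ ℓ′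
    ... | yes sep  = sep
    ... | no ¬sep = contradiction (ℕₚ.≤-trans gap (osc hx′ hx)) (ℕₚ.<-irrefl refl)
      where
      k = fR ℓ′
      x = ξ ℓ
      x′ = unshift (ξ k)
      hx = ξ-inUnit ℓ
      hx′ = unshift-inUnit (ξ-inUnit k)
      shift-x′ : shift x′ ≡ ξ k
      shift-x′ = shift-unshift (ξ-inUnit k)
      D<arc : arc (ξ⁺ ℓ) (ξ⁺ ℓ′) < arc (ξ⁺ ℓ) (ξ k)
      D<arc = ≤∧≢⇒< (≮⇒≥ (¬sep ∘ (k ,_)))
                    (λ eq → ξ≢ξ⁺ k ℓ′ (sym (arc-injʳ (ξ⁺-inUnit ℓ) (ξ⁺-inUnit ℓ′) (ξ-inUnit k) eq)))
      ξℓ∈ : ξ ℓ ∈[ x , x′ ⟩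
      ξℓ∈ = <-resp-≡ (sym (arc-self hx)) refl (arc-pos hx hx′ (λ eq → ξ≢ξ⁺ k ℓ (trans (sym shift-x′) (cong shift (sym eq)))))
      ξℓ′∈ : ξ ℓ′ ∈[ x , x′ ⟩
      ξℓ′∈ = <-resp-≡ (arc-shift-shift hx (ξ-inUnit ℓ′)) (trans (cong (arc (ξ⁺ ℓ)) (sym shift-x′)) (arc-shift-shift hx hx′)) D<arc
      none-after : #ξ (shift x) (shift x′) ≡ 0
      none-after = count≡0 (λ j → ξ j ∈[ shift x , shift x′ ⟩?)
        (λ j ξj∈ → unseparated⇒rightNeighbour ¬sep j (subst (λ t → arc (ξ⁺ ℓ) (ξ j) < arc (ξ⁺ ℓ) t) shift-x′ ξj∈))
      gap : 2 ℕ.+ window x′ ≤ window x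
      gap = begin
        2 ℕ.+ window x′                         ≡⟨ ℕₚ.+-comm 2 _ ⟩
        window x′ ℕ.+ 2                         ≤⟨ ℕₚ.+-monoʳ-≤ (window x′) (2≤count (λ j → ξ j ∈[ x , x′ ⟩?) ℓ≢ℓ′ ξℓ∈ ξℓ′∈) ⟩
        window x′ ℕ.+ #ξ x x′                   ≡⟨ window-slide hx hx′ ⟩
        window x ℕ.+ #ξ (shift x) (shift x′)    ≡⟨ cong (window x ℕ.+_) none-after ⟩
        window x ℕ.+ 0                          ≡⟨ ℕₚ.+-identityʳ _ ⟩
        window x                                ∎
        where open ℕₚ.≤-Reasoning

    nextξ⁺ : Fin m → Fin m
    nextξ⁺ j = argmin m (λ ℓ → arc (ξ j) (ξ⁺ ℓ)) j

    Gap : Fin m → ℝ → Set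
    Gap j y = 0r < arc (ξ j) y × arc (ξ j) y ≤ℝ arc (ξ j) (ξ⁺ (nextξ⁺ j))

    gap-nextξ⁺ : ∀ j → Gap j (ξ⁺ (nextξ⁺ j))
    gap-nextξ⁺ j = arc-pos (ξ-inUnit j) (ξ⁺-inUnit _) (ξ≢ξ⁺ j _) , inj₂ refl

    gap-of-∈ : ∀ {y j} → InUnit y → ξ⁺ (nextξ⁺ j) ∈[ y , ξ j ⟩ → Gap j y
    gap-of-∈ {y} {j} hy ∈yξ =
      arc-pos (ξ-inUnit j) hy (∈[,⟩⇒≢ hy (ξ⁺-inUnit _) ∈yξ ∘ sym) ,
      ∈[,⟩⇒arc-≤ hy (ξ-inUnit j) (ξ⁺-inUnit _) ∈yξ

    module _ (inter : Interlaced) where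

      ξ⁺-between : ∀ {i k} → i ≢ k → ∃ λ ℓ → ξ⁺ ℓ ∈[ ξ i , ξ k ⟩
      ξ⁺-between {i} {k} i≢k = ℓ , ≤∧≢⇒< (≮⇒≥ ξk∉) ξ⁺ℓ≢ξk
        where
        preimage = injective⇒strictlySurjective (interlaced⇒injective-fLeft inter) i
        ℓ = proj₁ preimage
        i-leftOfℓ : LeftNeighbour ℓ i
        i-leftOfℓ = subst (LeftNeighbour ℓ) (proj₂ preimage) (fLeft-leftNeighbour ℓ)
        ξk∉ : ¬ (ξ k ∈[ ξ i , ξ⁺ ℓ ⟩)
        ξk∉ ξk∈ = i-leftOfℓ k (∈[,⟩⇒arc-< (ξ-inUnit i) (ξ⁺-inUnit ℓ) (ξ-inUnit k) ξk∈ (i≢k ∘ ξ-injective))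
        ξ⁺ℓ≢ξk : arc (ξ i) (ξ⁺ ℓ) ≢ arc (ξ i) (ξ k)
        ξ⁺ℓ≢ξk eq = ξ≢ξ⁺ k ℓ (sym (arc-injʳ (ξ-inUnit i) (ξ⁺-inUnit ℓ) (ξ-inUnit k) eq))

      ¬nested-gaps : ∀ {y i i′} → InUnit y → arc (ξ i′) y < arc (ξ i) y → Gap i y → ¬ Gap i′ y
      ¬nested-gaps {y} {i} {i′} hy lt (_ , y≤) (0<arc , _) =
        argmin-isMin (λ ℓ → arc (ξ i) (ξ⁺ ℓ)) i (proj₁ between) (<-trans (proj₂ between) (<-≤-trans ξi′∈ y≤))
        where
        i≢i′ : i ≢ i′
        i≢i′ refl = <-irrefl lt
        between = ξ⁺-between i≢i′
        ξi′≢y : ξ i′ ≢ y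
        ξi′≢y refl = <-irrefl (<-resp-≡ refl (arc-self hy) 0<arc)
        ξi′∈ : ξ i′ ∈[ ξ i , y ⟩
        ξi′∈ = arc-<⇒∈[,⟩ (ξ-inUnit i) hy (ξ-inUnit i′) lt ξi′≢y

      gaps-disjoint : ∀ {y j j′} → InUnit y → Gap j y → Gap j′ y → j ≡ j′
      gaps-disjoint {y} {j} {j′} hy gap gap′ with compare (arc (ξ j′) y) (arc (ξ j) y)
      ... | tri< lt _ _ = contradiction gap′ (¬nested-gaps hy lt gap)
      ... | tri≈ _ eq _ = sym (ξ-injective (arc-injˡ (ξ-inUnit j′) (ξ-inUnit j) hy eq))
      ... | tri> _ _ gt = contradiction gap (¬nested-gaps hy gt gap′)

      nextξ⁺-injective : Injective _≡_ _≡_ nextξ⁺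
      nextξ⁺-injective {j} {j′} eq =
        gaps-disjoint (ξ⁺-inUnit _) (gap-nextξ⁺ j) (subst (Gap j′ ∘ ξ⁺) (sym eq) (gap-nextξ⁺ j′))

      -- Pair ξ j with b j, the first point of A + δ after it: the pairing is injective, and only
      -- the pair whose gap contains y′ can straddle y′.
      #ξ≤1+#ξ⁺ : ∀ {y y′} → InUnit y → InUnit y′ → #ξ y y′ ≤ suc (#ξ⁺ y y′)
      #ξ≤1+#ξ⁺ {y} {y′} hy hy′ = begin
        #ξ y y′                                       ≤⟨ ℕₚ.m≤m+n _ _ ⟩
        #ξ y y′ ℕ.+ sum before                        ≡⟨ ∑-distrib-+ (λ j → 𝟙 (ξ j ∈[ y , y′ ⟩?)) before ⟨
        sum (λ j → 𝟙 (ξ j ∈[ y , y′ ⟩?) ℕ.+ before j) ≡⟨ sum-cong-≗ pointwise ⟩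
        sum (λ j → inside j ℕ.+ after j)              ≡⟨ ∑-distrib-+ inside after ⟩
        sum inside ℕ.+ sum after                      ≡⟨ cong (ℕ._+ sum after) (sum-reindex (λ ℓ → 𝟙 (ξ⁺ ℓ ∈[ y , y′ ⟩?)) nextξ⁺-injective) ⟩
        #ξ⁺ y y′ ℕ.+ sum after                        ≤⟨ ℕₚ.+-monoʳ-≤ (#ξ⁺ y y′) after≤1 ⟩
        #ξ⁺ y y′ ℕ.+ 1                                ≡⟨ ℕₚ.+-comm _ 1 ⟩
        suc (#ξ⁺ y y′)                                ∎
        where
        open ℕₚ.≤-Reasoning
        b : Fin m → ℝ
        b j = ξ⁺ (nextξ⁺ j)
        before inside after : Fin m → ℕ
        before j = 𝟙 (b j ∈[ y , ξ j ⟩?)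
        inside j = 𝟙 (b j ∈[ y , y′ ⟩?)
        after  j = 𝟙 (b j ∈[ y′ , ξ j ⟩?)
        pointwise : ∀ j → 𝟙 (ξ j ∈[ y , y′ ⟩?) ℕ.+ before j ≡ inside j ℕ.+ after j
        pointwise j = trans (ℕₚ.+-comm (𝟙 (ξ j ∈[ y , y′ ⟩?)) _) (sym (𝟙-arc-concat hy hy′ (ξ-inUnit j) (ξ⁺-inUnit _)))
        after≤1 : sum after ≤ 1
        after≤1 = count≤1 (λ j → b j ∈[ y′ , ξ j ⟩?) (λ p q → gaps-disjoint hy′ (gap-of-∈ hy′ p) (gap-of-∈ hy′ q))

      interlaced⇒oscillation≤1 : Oscillation≤1
      interlaced⇒oscillation≤1 {x} {x′} hx hx′ = ℕₚ.+-cancelʳ-≤ (#ξ x x′) _ _ (begin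
        window x′ ℕ.+ #ξ x x′                         ≡⟨ window-slide hx hx′ ⟩
        window x ℕ.+ #ξ (shift x) (shift x′)          ≤⟨ ℕₚ.+-monoʳ-≤ (window x) (#ξ≤1+#ξ⁺ (shift-inUnit hx) (shift-inUnit hx′)) ⟩
        window x ℕ.+ suc (#ξ⁺ (shift x) (shift x′))   ≡⟨ cong (λ t → window x ℕ.+ suc t) (#ξ≡#ξ⁺-shift hx hx′) ⟨
        window x ℕ.+ suc (#ξ x x′)                    ≡⟨ ℕₚ.+-suc (window x) (#ξ x x′) ⟩
        suc (window x) ℕ.+ #ξ x x′                    ∎)
        where open ℕₚ.≤-Reasoning

    balanced⇔interlaced : Balanced m ξ δ ⇔ Interlaced
    balanced⇔interlaced = mk⇔ (oscillation≤1⇒interlaced ∘ balanced⇒oscillation≤1)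
                              (oscillation≤1⇒balanced ∘ interlaced⇒oscillation≤1)

lemma4p3 : (R : RealAxioms) → let open Torus R in
    (m : ℕ) (ξ : Fin m → ℝ) (δ : ℝ) →
    (∀ i → InUnit (ξ i)) →
    Injective _≡_ _≡_ ξ →
    0r < δ → δ < 1r →
    (∀ i j → ¬ (frac (ξ i - ξ j) ≡ δ)) →
    (Balanced m ξ δ ⇔ Bijective _≡_ _≡_ (fLeft m ξ δ))
    × (Balanced m ξ δ ⇔ Bijective _≡_ _≡_ (fRight m ξ δ))
lemma4p3 R m ξ δ ξ-inUnit ξ-injective 0<δ δ<1 δ-avoids-gaps =
  interlaced⇔bijective-fLeft ⇔-∘ balanced⇔interlaced ,
  interlaced⇔bijective-fRight ⇔-∘ balanced⇔interlaced
  where open Configuration.Points R m ξ δ ξ-inUnit ξ-injective 0<δ δ<1 δ-avoids-gaps
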